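{- Let $n$ be a power of an odd prime, $q=n^2$, $r=(n+1)/2$, let $V$ be a $2$-dimensional vector space over $\mathbb{F}_q$ with nondegenerate symplectic form $B$, $R$ the subgroup of index $r$ in $\mathbb{F}_q^*$, and $\Gamma^{(n)}$ the graph with vertices $Ru$ ($u\in V\setminus\{0\}$) and $Ru\sim Rv$ iff $B(u,v)\in R$. Let $\{e,f\}$ be a basis of $V$ with $B(e,f)=-B(f,e)=1$, let $x := Re$ and $y := R(\beta^{ -1}f)$ where $\beta\in\mathbb{F}_q^*\setminus R$. Then: (1) $y$ is at distance $2$ from $x$, and $\Gamma^{(n)}(x)\cap\Gamma^{(n)}(y) = \{R(\alpha e+f) : \alpha\in R\beta\}$, which has size $2(n-1)$. Two distinct vertices $R(\alpha e+f), R(\alpha' e+f)$ of this set are adjacent iff $\alpha' = \alpha(\beta_{ev}\beta_{odd}^{ -1})^{\pm1}$. (2) The $\mu$-graph $\mu(x,y)$ is a disjoint union of $d := 2(n-1)/|\beta_{ev}\beta_{odd}^{ -1}|$ cycles of length $2(n-1)/d$.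
   Context: $\omega$ is a fixed primitive element of $\mathbb{F}_q$, $\mathbb{F}_n$ the subfield of order $n$, so $R=\langle\omega^r\rangle=\mathbb{F}_n^*\cup\mathbb{F}_n^*\omega^r$ and each $\alpha\in\mathbb{F}_q$ is uniquely $\alpha=\alpha_{ev}+\alpha_{odd}$ with $\alpha_{ev}\in\mathbb{F}_n$, $\alpha_{odd}\in\mathbb{F}_n\omega^r$. $R\beta$ is the coset $\{\rho\beta:\rho\in R\}$. $|\gamma|$ denotes the multiplicative order of $\gamma\in\mathbb{F}_q^*$. $\mu(x,y)$ is the induced subgraph on the common neighbours of $x$ and $y$. -}

module Defs where

open import Level using (0ℓ)
open import Data.Nat using (ℕ; zero; suc; _/_; _≤_) renaming (_+_ to _+ℕ_; _*_ to _*ℕ_)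
open import Data.Fin using (Fin; toℕ)
open import Data.Product using (Σ; ∃; _×_; _,_)
open import Data.Sum using (_⊎_)
open import Relation.Binary.PropositionalEquality using (_≡_; _≢_)
open import Relation.Nullary using (¬_)
open import Algebra.Structures using (IsCommutativeRing)

Iff : Set → Set → Set
Iff A C = (A → C) × (C → A)

record Field : Set₁ where
  infixl 6 _+_ _-_
  infixl 7 _*_
  field
    Carrier : Set
    _+_ _*_ : Carrier → Carrier → Carrier
    -_ : Carrier → Carrier
    0# 1# : Carrier
    isCommutativeRing : IsCommutativeRing _≡_ _+_ _*_ -_ 0# 1#
    0≢1 : 0# ≢ 1#
    inverse : ∀ x → x ≢ 0# → ∃ λ y → x * y ≡ 1#

  _-_ : Carrier → Carrier → Carrier
  x - y = x + (- y)

  _^_ : Carrier → ℕ → Carrier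
  x ^ zero = 1#
  x ^ suc k = x * (x ^ k)

-- Everything below depends on the field F, the number n (so q = n²), and the
-- fixed primitive element ω.
module Setup (F : Field) (n : ℕ) (ω : Field.Carrier F) where
  open Field F

  r : ℕ
  r = (n +ℕ 1) / 2

  Primitive : Set
  Primitive = ∀ x → x ≢ 0# → ∃ λ (i : ℕ) → ω ^ i ≡ x

  InR : Carrier → Set
  InR x = ∃ λ (i : ℕ) → x ≡ (ω ^ r) ^ i

  InRcoset : Carrier → Carrier → Set
  InRcoset β α = ∃ λ ρ → InR ρ × α ≡ ρ * β

  -- the subfield F_n of order n (inside F_q, q = n²): fixed points of x ↦ x^n
  InFn : Carrier → Set
  InFn x = x ^ n ≡ x

  InFnωr : Carrier → Set
  InFnωr x = ∃ λ c → InFn c × x ≡ c * (ω ^ r)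

  EvOdd : Carrier → Carrier → Carrier → Set
  EvOdd α αev αodd = InFn αev × InFnωr αodd × α ≡ αev + αodd

  IsOrder : Carrier → ℕ → Set
  IsOrder γ m = (1 ≤ m) × γ ^ m ≡ 1# × (∀ k → 1 ≤ k → γ ^ k ≡ 1# → m ≤ k)

  V : Set
  V = Carrier × Carrier

  e f : V
  e = 1# , 0#
  f = 0# , 1#

  _·_ : Carrier → V → V
  c · (a , b) = (c * a) , (c * b)

  _⊕_ : V → V → V
  (a , b) ⊕ (c , d) = (a + c) , (b + d)

  B : V → V → Carrier
  B (a , b) (c , d) = a * d - b * c

  NonZeroV : V → Set
  NonZeroV u = u ≢ (0# , 0#)

  SameVertex : V → V → Set
  SameVertex u v = ∃ λ ρ → InR ρ × v ≡ ρ · u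

  Adj : V → V → Set
  Adj u v = InR (B u v)

  Dist2 : V → V → Set
  Dist2 u v = ¬ SameVertex u v × ¬ Adj u v × ∃ λ w → NonZeroV w × Adj u w × Adj w v

  CommonNbr : V → V → V → Set
  CommonNbr x y w = NonZeroV w × Adj x w × Adj y w

  HasSize : (V → Set) → ℕ → Set
  HasSize P m = Σ (Fin m → V) λ g →
      (∀ i → NonZeroV (g i) × P (g i))
    × (∀ i j → SameVertex (g i) (g j) → i ≡ j)
    × (∀ w → NonZeroV w → P w → ∃ λ i → SameVertex (g i) w)

  CycSucc : (L : ℕ) → Fin L → Fin L → Set
  CycSucc L j j' = toℕ j' ≡ suc (toℕ j) ⊎ (toℕ j' ≡ 0 × suc (toℕ j) ≡ L)

  -- the induced subgraph on {Rw : P w} is a disjoint union of d cycles of length L: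
  -- its vertices are labelled bijectively by Fin d × Fin L, and two of them are
  -- adjacent iff they lie on the same cycle and are consecutive on it
  DisjointCycles : (V → Set) → ℕ → ℕ → Set
  DisjointCycles P d L = Σ (Fin d → Fin L → V) λ g →
      (∀ i j → NonZeroV (g i j) × P (g i j))
    × (∀ i j i' j' → SameVertex (g i j) (g i' j') → (i ≡ i') × (j ≡ j'))
    × (∀ w → NonZeroV w → P w → ∃ λ i → ∃ λ j → SameVertex (g i j) w)
    × (∀ i j i' j' → Iff (Adj (g i j) (g i' j')) ((i ≡ i') × (CycSucc L j j' ⊎ CycSucc L j' j)))

module Submission where

open import Defs
open import Data.Nat using (ℕ; suc; _∸_) renaming (_*_ to _*ℕ_; _^_ to _^ℕ_)
open import Data.Nat.Primality using (Prime)
open import Data.Fin using (Fin)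
open import Data.Product using (∃; _×_; _,_)
open import Data.Sum using (_⊎_)
open import Relation.Binary.PropositionalEquality using (_≡_; _≢_)
open import Relation.Nullary using (¬_)
open import Function.Bundles using (_↔_)
open import Relation.Binary.PropositionalEquality using (refl)

-- Write n = 2T + 1, so q = n², r = T + 1, |F_q^*| = q - 1 = r · 2(n - 1), and
-- put s = ω^r, a generator of R, whose order is 2(n - 1).  The Frobenius map
-- x ↦ x^n is additive, so its fixed field E = F_n is a subfield; s^n = -s
-- shows s ∉ E and s² ∈ E.  Hence F_q = E ⊕ E·s, the group R consists exactly
-- of the nonzero elements of E ∪ E·s, and an element u + v·s (u, v ∈ E) lies
-- in R iff u = 0 or v = 0.
--
-- With e = (1,0), f = (0,1) the common neighbours of x = Re and y = R(β⁻¹f)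
-- are the vertices R(α, 1) with α ∈ Rβ, listed without repetition as
-- R(s^i β, 1), 0 ≤ i < 2(n - 1).  Two of them, α and α' = tα (t ∈ R, t ≠ 1),
-- are adjacent iff (1 - t)β ∈ R, and expanding (1 - t)β in the basis 1, s
-- shows this happens iff t = γ or tγ = 1 (key lemma).  So μ(x,y) is the
-- Cayley graph of the cyclic group R (acting on Rβ) for the generators γ^{±1}
-- with γ ∈ R of order m: it splits into the d = 2(n - 1)/m cosets of ⟨γ⟩,
-- each a cycle s^i γ^j β (0 ≤ j < m).

module NatFacts where
  open import Data.Nat
  open import Data.Nat.Properties
  open import Data.Nat.Combinatorics
  open import Data.Nat.Combinatorics.Specification using (k>n⇒nCk≡0)
  open import Data.Nat.Divisibility
  open import Data.Nat.Primality
  open import Data.Sum using (inj₁; inj₂)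
  open import Data.Empty using (⊥-elim)
  open import Relation.Nullary using (yes; no)
  import Data.Fin as Fin
  import Data.Fin.Properties as FinP
  open import Relation.Binary.PropositionalEquality
  open import Data.Nat.Solver using (module +-*-Solver)
  open +-*-Solver

  absorption : ∀ n k → suc k * (suc n C suc k) ≡ suc n * (n C k)
  absorption zero zero = refl
  absorption zero (suc k) = begin
      suc (suc k) * (1 C suc (suc k)) ≡⟨ cong (suc (suc k) *_) (k>n⇒nCk≡0 {1} {suc (suc k)} (s≤s (s≤s z≤n))) ⟩
      suc (suc k) * 0                 ≡⟨ *-zeroʳ (suc (suc k)) ⟩
      0                               ≡⟨ cong (1 *_) (k>n⇒nCk≡0 {0} {suc k} (s≤s z≤n)) ⟨
      1 * (0 C suc k)                 ∎
    where open ≡-Reasoning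
  absorption (suc n) zero = trans (*-identityˡ _) (trans (nC1≡n (suc (suc n))) (sym (*-identityʳ (suc (suc n)))))
  absorption (suc n) (suc j) = begin
      (2 + j) * (suc (suc n) C suc (suc j))  ≡⟨ cong ((2 + j) *_) (sym (nCk+nC[k+1]≡[n+1]C[k+1] (suc n) (suc j))) ⟩
      (2 + j) * (A + B)                      ≡⟨ solve 3 (λ j A B → (con 2 :+ j) :* (A :+ B) := ((con 1 :+ j) :* A) :+ A :+ ((con 2 :+ j) :* B)) refl j A B ⟩
      (1 + j) * A + A + (2 + j) * B          ≡⟨ cong₂ (λ u v → u + A + v) (absorption n j) (absorption n (suc j)) ⟩
      (1 + n) * a + A + (1 + n) * b          ≡⟨ solve 4 (λ n a b A → (con 1 :+ n) :* a :+ A :+ (con 1 :+ n) :* b := (con 1 :+ n) :* (a :+ b) :+ A) refl n a b A ⟩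
      (1 + n) * (a + b) + A                  ≡⟨ cong (λ u → (1 + n) * u + A) (nCk+nC[k+1]≡[n+1]C[k+1] n j) ⟩
      (1 + n) * A + A                        ≡⟨ solve 2 (λ n A → (con 1 :+ n) :* A :+ A := (con 2 :+ n) :* A) refl n A ⟩
      (2 + n) * A                            ∎
    where
    open ≡-Reasoning
    A B a b : ℕ
    A = suc n C suc j
    B = suc n C suc (suc j)
    a = n C j
    b = n C suc j

  prime∣binomial : ∀ {p} → Prime p → ∀ k → 0 < k → k < p → p ∣ p C k
  prime∣binomial {suc p'} p-prime (suc k) _ k<p
    with euclidsLemma (suc k) (suc p' C suc k) p-prime
           (divides (p' C k) (trans (absorption p' k) (*-comm (suc p') (p' C k))))
  ... | inj₂ p∣C = p∣C
  ... | inj₁ p∣k+1 = ⊥-elim (<⇒≱ k<p (∣⇒≤ p∣k+1))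

  even-or-odd : ∀ i → ∃ λ j → i ≡ 2 * j ⊎ i ≡ suc (2 * j)
  even-or-odd zero = 0 , inj₁ refl
  even-or-odd (suc zero) = 0 , inj₂ refl
  even-or-odd (suc (suc i)) with even-or-odd i
  ... | j , inj₁ refl = suc j , inj₁ (solve 1 (λ j → con 2 :+ con 2 :* j := con 2 :* (con 1 :+ j)) refl j)
  ... | j , inj₂ refl = suc j , inj₂ (solve 1 (λ j → con 3 :+ con 2 :* j := con 1 :+ con 2 :* (con 1 :+ j)) refl j)

  odd-prime : ∀ p → Prime p → p ≢ 2 → ∃ λ a → p ≡ suc (2 * suc a)
  odd-prime p p-prime p≢2 with even-or-odd p
  ... | zero , inj₁ refl = ⊥-elim (¬prime[0] p-prime)
  ... | suc zero , inj₁ refl = ⊥-elim (p≢2 refl)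
  ... | suc (suc j) , inj₁ refl =
        ⊥-elim (Prime.notComposite p-prime (composite-≢ 2 2≢p (divides (suc (suc j)) (*-comm 2 (suc (suc j))))))
    where
    2≢p : 2 ≢ 2 * suc (suc j)
    2≢p e = <-irrefl e (*-monoʳ-< 2 {1} {suc (suc j)} (s≤s (s≤s z≤n)))
  ... | zero , inj₂ refl = ⊥-elim (¬prime[1] p-prime)
  ... | suc j , inj₂ refl = j , refl

  odd-power : ∀ a k → ∃ λ T → suc (2 * suc a) ^ suc k ≡ suc (2 * suc T)
  odd-power a zero = a , *-identityʳ _
  odd-power a (suc k) with odd-power a k
  ... | T , eq = 2 * suc a * suc T + a + suc T , trans (cong (suc (2 * suc a) *_) eq) (odd-product a T)
    where
    odd-product : ∀ a T → suc (2 * suc a) * suc (2 * suc T) ≡ suc (2 * suc (2 * suc a * suc T + a + suc T))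
    odd-product = solve 2 (λ a t → (con 1 :+ con 2 :* (con 1 :+ a)) :* (con 1 :+ con 2 :* (con 1 :+ t))
                                   := con 1 :+ con 2 :* (con 1 :+ (con 2 :* (con 1 :+ a) :* (con 1 :+ t) :+ a :+ (con 1 :+ t)))) refl

  -- For n = 2T + 1: (n + 1)/2 = T + 1 and n² - 1 = (T + 1) · 2(n - 1).
  half-odd-successor : ∀ T → (suc (2 * T) + 1) / 2 ≡ suc T
  half-odd-successor T = trans (cong (_/ 2) (solve 1 (λ t → con 1 :+ con 2 :* t :+ con 1 := (con 1 :+ t) :* con 2) refl T))
                               (m*n/n≡m (suc T) 2)
    where open import Data.Nat.DivMod using (m*n/n≡m)

  odd-square-pred : ∀ T → 2 * T + 2 * T * suc (2 * T) ≡ suc T * (2 * (2 * T))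
  odd-square-pred = solve 1 (λ t → con 2 :* t :+ con 2 :* t :* (con 1 :+ con 2 :* t) := (con 1 :+ t) :* (con 2 :* (con 2 :* t))) refl

  double-both : ∀ a b → a * (2 * b) ≡ (2 * a) * b
  double-both = solve 2 (λ a b → a :* (con 2 :* b) := (con 2 :* a) :* b) refl

  injective⇒surjective : ∀ {k} (g : Fin k → Fin k) → (∀ x y → g x ≡ g y → x ≡ y) → ∀ z → ∃ λ x → g x ≡ z
  injective⇒surjective {suc k} g g-injective z with FinP.any? (λ x → g x FinP.≟ z)
  ... | yes hit = hit
  ... | no miss = ⊥-elim (<-irrefl refl (FinP.injective⇒≤ {f = squeeze} squeeze-injective))
    where
    z≢g : ∀ x → z ≢ g x
    z≢g x e = miss (x , sym e)
    squeeze : Fin (suc k) → Fin k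
    squeeze x = Fin.punchOut (z≢g x)
    squeeze-injective : ∀ {x y} → squeeze x ≡ squeeze y → x ≡ y
    squeeze-injective {x} {y} e = g-injective x y (FinP.punchOut-injective (z≢g x) (z≢g y) e)

  odd-prime-power : ∀ p k n → Prime p → p ≢ 2 → n ≡ p ^ suc k →
                    ∃ λ p' → ∃ λ T' → p ≡ suc p' × n ≡ suc (2 * suc T')
  odd-prime-power p k n p-prime p≢2 n≡p^k+1 with odd-prime p p-prime p≢2
  ... | a , refl with odd-power a k
  ... | T , eq = suc (2 * suc a) ∸ 1 , T , refl , trans n≡p^k+1 eq

-- The integers map into every field; this morphism lets the standard
-- library's ring solver prove polynomial identities (with integer
-- coefficients) in any field F.
module IntegerSolver (F : Field) where
  open import Data.Nat as ℕ using (ℕ; zero; suc)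
  import Data.Nat.Properties as ℕP
  open import Data.Integer as ℤ using (ℤ; -[1+_]; sign; ∣_∣; _◃_)
  import Data.Integer.Properties as ℤP
  open import Data.Sign as Sign using (Sign)
  open import Data.Sum using (inj₁; inj₂)
  open import Data.Maybe using (Maybe; nothing; just)
  open import Relation.Nullary using (yes; no)
  open import Relation.Binary.PropositionalEquality
  open import Algebra.Bundles using (CommutativeRing)
  import Algebra.Properties.Ring as RingProperties
  import Algebra.Solver.Ring.AlmostCommutativeRing as ACR
  import Algebra.Solver.Ring as RingSolver
  open Field F

  commutativeRing : CommutativeRing _ _
  commutativeRing = record { isCommutativeRing = isCommutativeRing }

  open CommutativeRing commutativeRing using (+-assoc; +-comm; +-identityˡ; +-identityʳ; -‿inverseˡ; -‿inverseʳ)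
  open RingProperties (CommutativeRing.ring commutativeRing)
    using (-‿involutive; -‿distribˡ-*; -‿distribʳ-*; -0#≈0#; -‿anti-homo-+)
  open import Algebra.Properties.Semiring.Mult.TCOptimised (CommutativeRing.semiring commutativeRing)
    using (×-homo-+; ×1-homo-*) renaming (_×_ to _·ℕ_)

  -- the image of a natural number; 1 × 1# reduces to 1#
  natF : ℕ → Carrier
  natF k = k ·ℕ 1#

  ⟦_⟧ : ℤ → Carrier
  ⟦ ℤ.+ k ⟧ = natF k
  ⟦ -[1+ k ] ⟧ = - natF (suc k)

  x-y+y : ∀ x y → (x - y) + y ≡ x
  x-y+y x y = trans (+-assoc _ _ _) (trans (cong (x +_) (-‿inverseˡ y)) (+-identityʳ x))

  x+y-y : ∀ x y → (x + y) - y ≡ x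
  x+y-y x y = trans (+-assoc _ _ _) (trans (cong (x +_) (-‿inverseʳ y)) (+-identityʳ x))

  neg-homo : ∀ i → ⟦ ℤ.- i ⟧ ≡ - ⟦ i ⟧
  neg-homo -[1+ k ] = sym (-‿involutive _)
  neg-homo (ℤ.+ zero) = sym -0#≈0#
  neg-homo (ℤ.+ suc k) = refl

  ⊖-homo : ∀ m n → ⟦ m ℤ.⊖ n ⟧ ≡ natF m - natF n
  ⊖-homo m n with ℕP.≤-<-connex n m
  ... | inj₁ n≤m = begin
      ⟦ m ℤ.⊖ n ⟧                          ≡⟨ cong ⟦_⟧ (ℤP.⊖-≥ n≤m) ⟩
      natF (m ℕ.∸ n)                        ≡⟨ sym (x+y-y _ _) ⟩
      (natF (m ℕ.∸ n) + natF n) - natF n    ≡⟨ cong (_- natF n) (sym (×-homo-+ 1# (m ℕ.∸ n) n)) ⟩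
      natF (m ℕ.∸ n ℕ.+ n) - natF n         ≡⟨ cong (λ z → natF z - natF n) (ℕP.m∸n+n≡m n≤m) ⟩
      natF m - natF n                       ∎
    where open ≡-Reasoning
  ... | inj₂ m<n = begin
      ⟦ m ℤ.⊖ n ⟧                          ≡⟨ cong ⟦_⟧ (ℤP.⊖-< m<n) ⟩
      ⟦ ℤ.- (ℤ.+ (n ℕ.∸ m)) ⟧              ≡⟨ neg-homo (ℤ.+ (n ℕ.∸ m)) ⟩
      - natF (n ℕ.∸ m)                      ≡⟨ sym (x-y+y _ _) ⟩
      (- natF (n ℕ.∸ m) - natF m) + natF m  ≡⟨ cong (_+ natF m) (sym (-‿anti-homo-+ _ _)) ⟩
      - (natF m + natF (n ℕ.∸ m)) + natF m  ≡⟨ cong (λ z → - z + natF m) (sym (×-homo-+ 1# m (n ℕ.∸ m))) ⟩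
      - natF (m ℕ.+ (n ℕ.∸ m)) + natF m     ≡⟨ cong (λ z → - natF z + natF m) (ℕP.m+[n∸m]≡n (ℕP.<⇒≤ m<n)) ⟩
      - natF n + natF m                     ≡⟨ +-comm _ _ ⟩
      natF m - natF n                       ∎
    where open ≡-Reasoning

  plus-homo : ∀ i j → ⟦ i ℤ.+ j ⟧ ≡ ⟦ i ⟧ + ⟦ j ⟧
  plus-homo -[1+ m ] -[1+ n ] = begin
      - natF (suc (suc (m ℕ.+ n)))           ≡⟨ cong (λ z → - natF (suc z)) (sym (ℕP.+-suc m n)) ⟩
      - natF (suc m ℕ.+ suc n)               ≡⟨ cong -_ (×-homo-+ 1# (suc m) (suc n)) ⟩
      - (natF (suc m) + natF (suc n))        ≡⟨ -‿anti-homo-+ _ _ ⟩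
      - natF (suc n) - natF (suc m)          ≡⟨ +-comm _ _ ⟩
      - natF (suc m) + - natF (suc n)        ∎
    where open ≡-Reasoning
  plus-homo -[1+ m ] (ℤ.+ n) = trans (⊖-homo n (suc m)) (+-comm _ _)
  plus-homo (ℤ.+ m) -[1+ n ] = ⊖-homo m (suc n)
  plus-homo (ℤ.+ m) (ℤ.+ n) = ×-homo-+ 1# m n

  signed : Sign → Carrier → Carrier
  signed Sign.+ x = x
  signed Sign.- x = - x

  ◃-homo : ∀ s k → ⟦ s ◃ k ⟧ ≡ signed s (natF k)
  ◃-homo Sign.+ zero = refl
  ◃-homo Sign.- zero = sym -0#≈0#
  ◃-homo Sign.+ (suc k) = refl
  ◃-homo Sign.- (suc k) = refl

  signed-* : ∀ s t a b → signed (s Sign.* t) (a * b) ≡ signed s a * signed t b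
  signed-* Sign.+ Sign.+ a b = refl
  signed-* Sign.+ Sign.- a b = -‿distribʳ-* a b
  signed-* Sign.- Sign.+ a b = -‿distribˡ-* a b
  signed-* Sign.- Sign.- a b = trans (sym (-‿involutive _)) (trans (cong -_ (-‿distribʳ-* a b)) (-‿distribˡ-* a (- b)))

  sign-abs : ∀ i → ⟦ i ⟧ ≡ signed (sign i) (natF ∣ i ∣)
  sign-abs -[1+ k ] = refl
  sign-abs (ℤ.+ k) = refl

  times-homo : ∀ i j → ⟦ i ℤ.* j ⟧ ≡ ⟦ i ⟧ * ⟦ j ⟧
  times-homo i j = begin
      ⟦ (sign i Sign.* sign j) ◃ (∣ i ∣ ℕ.* ∣ j ∣) ⟧                ≡⟨ ◃-homo (sign i Sign.* sign j) (∣ i ∣ ℕ.* ∣ j ∣) ⟩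
      signed (sign i Sign.* sign j) (natF (∣ i ∣ ℕ.* ∣ j ∣))        ≡⟨ cong (signed (sign i Sign.* sign j)) (×1-homo-* ∣ i ∣ ∣ j ∣) ⟩
      signed (sign i Sign.* sign j) (natF ∣ i ∣ * natF ∣ j ∣)       ≡⟨ signed-* (sign i) (sign j) (natF ∣ i ∣) (natF ∣ j ∣) ⟩
      signed (sign i) (natF ∣ i ∣) * signed (sign j) (natF ∣ j ∣)   ≡⟨ sym (cong₂ _*_ (sign-abs i) (sign-abs j)) ⟩
      ⟦ i ⟧ * ⟦ j ⟧                                                 ∎
    where open ≡-Reasoning

  almostCommutativeRing : ACR.AlmostCommutativeRing _ _
  almostCommutativeRing = ACR.fromCommutativeRing commutativeRing

  ℤ-morphism : ℤ.+-*-rawRing ACR.-Raw-AlmostCommutative⟶ almostCommutativeRing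
  ℤ-morphism = record
    { ⟦_⟧ = ⟦_⟧ ; +-homo = plus-homo ; *-homo = times-homo ; -‿homo = neg-homo
    ; 0-homo = refl ; 1-homo = refl }

  coefficient-equality : ∀ i j → Maybe (⟦ i ⟧ ≡ ⟦ j ⟧)
  coefficient-equality i j with i ℤP.≟ j
  ... | yes i≡j = just (cong ⟦_⟧ i≡j)
  ... | no _ = nothing

  open RingSolver ℤ.+-*-rawRing almostCommutativeRing ℤ-morphism coefficient-equality public
    using (solve; _:=_; _:+_; _:*_; _:-_; :-_; con; Polynomial)

  :0 :1 : ∀ {k} → Polynomial k
  :0 = con (ℤ.+ 0)
  :1 = con (ℤ.+ 1)

module FieldLemmas (F : Field) where
  open import Data.Nat as ℕ using (ℕ; zero; suc)
  import Data.Nat.Properties as ℕP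
  open import Data.Nat.DivMod using (_%_; _/_; m≡m%n+[m/n]*n; m%n<n)
  open import Data.Product using (proj₁; proj₂)
  open import Data.Empty using (⊥-elim)
  open import Relation.Binary.PropositionalEquality
  open import Relation.Binary.Definitions using (tri<; tri≈; tri>)
  open import Algebra.Bundles using (CommutativeRing)
  import Algebra.Properties.Ring as RingProperties
  open Field F
  open IntegerSolver F public
  open CommutativeRing commutativeRing public
    using (+-assoc; +-comm; *-assoc; *-comm; +-identityˡ; +-identityʳ; *-identityˡ; *-identityʳ;
           distribʳ; zeroˡ; zeroʳ; -‿inverseˡ; -‿inverseʳ)
  open RingProperties (CommutativeRing.ring commutativeRing) public
    using (-‿involutive; -‿distribʳ-*; -0#≈0#)

  1≢0 : 1# ≢ 0#
  1≢0 e = 0≢1 (sym e)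

  -1≢0 : - 1# ≢ 0#
  -1≢0 e = 1≢0 (trans (sym (-‿involutive 1#)) (trans (cong -_ e) -0#≈0#))

  inv : (x : Carrier) → x ≢ 0# → Carrier
  inv x x≢0 = proj₁ (inverse x x≢0)

  inv-r : ∀ x (x≢0 : x ≢ 0#) → x * inv x x≢0 ≡ 1#
  inv-r x x≢0 = proj₂ (inverse x x≢0)

  inv-l : ∀ x (x≢0 : x ≢ 0#) → inv x x≢0 * x ≡ 1#
  inv-l x x≢0 = trans (*-comm _ _) (inv-r x x≢0)

  inv≢0 : ∀ x (x≢0 : x ≢ 0#) → inv x x≢0 ≢ 0#
  inv≢0 x x≢0 i≡0 = 1≢0 (trans (sym (inv-r x x≢0)) (trans (cong (x *_) i≡0) (zeroʳ x)))

  cancelˡ : ∀ {x y z} → x ≢ 0# → x * y ≡ x * z → y ≡ z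
  cancelˡ {x} {y} {z} x≢0 e = begin
      y                    ≡⟨ sym (*-identityˡ y) ⟩
      1# * y               ≡⟨ cong (_* y) (sym (inv-l x x≢0)) ⟩
      (inv x x≢0 * x) * y  ≡⟨ *-assoc _ _ _ ⟩
      inv x x≢0 * (x * y)  ≡⟨ cong (inv x x≢0 *_) e ⟩
      inv x x≢0 * (x * z)  ≡⟨ sym (*-assoc _ _ _) ⟩
      (inv x x≢0 * x) * z  ≡⟨ cong (_* z) (inv-l x x≢0) ⟩
      1# * z               ≡⟨ *-identityˡ z ⟩
      z                    ∎
    where open ≡-Reasoning

  cancelʳ : ∀ {x y z} → x ≢ 0# → y * x ≡ z * x → y ≡ z
  cancelʳ {x} {y} {z} x≢0 e = cancelˡ x≢0 (trans (*-comm x y) (trans e (*-comm z x)))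

  mul-nz : ∀ {x y} → x ≢ 0# → y ≢ 0# → x * y ≢ 0#
  mul-nz {x} x≢0 y≢0 xy≡0 = y≢0 (cancelˡ x≢0 (trans xy≡0 (sym (zeroʳ x))))

  solve-linear : ∀ {x y z} (x≢0 : x ≢ 0#) → x * z ≡ y → inv x x≢0 * y ≡ z
  solve-linear {x} {y} {z} x≢0 e =
    cancelˡ x≢0 (trans (sym (*-assoc _ _ _)) (trans (cong (_* y) (inv-r x x≢0)) (trans (*-identityˡ y) (sym e))))

  sub≡0 : ∀ {a b} → a - b ≡ 0# → a ≡ b
  sub≡0 {a} {b} e = trans (sym (x-y+y a b)) (trans (cong (_+ b) e) (+-identityˡ b))

  +-cancelʳ : ∀ {a b c} → a + c ≡ b + c → a ≡ b
  +-cancelʳ {a} {b} {c} e = trans (sym (x+y-y a c)) (trans (cong (_- c) e) (x+y-y b c))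

  neg-unique : ∀ {a b} → a + b ≡ 0# → b ≡ - a
  neg-unique {a} {b} e = begin
      b              ≡⟨ sym (+-identityˡ b) ⟩
      0# + b         ≡⟨ cong (_+ b) (sym (-‿inverseˡ a)) ⟩
      (- a + a) + b  ≡⟨ +-assoc _ _ _ ⟩
      - a + (a + b)  ≡⟨ cong (- a +_) e ⟩
      - a + 0#       ≡⟨ +-identityʳ _ ⟩
      - a            ∎
    where open ≡-Reasoning

  x≢-x : natF 2 ≢ 0# → ∀ x → x ≢ 0# → x ≢ - x
  x≢-x 2≢0 x x≢0 x≡-x = x≢0 (cancelˡ 2≢0 (trans 2x≡0 (sym (zeroʳ _))))
    where
    2x≡0 : natF 2 * x ≡ 0#
    2x≡0 = trans (distribʳ x 1# 1#) (trans (cong₂ _+_ (*-identityˡ x) (*-identityˡ x))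
             (trans (cong (x +_) x≡-x) (-‿inverseʳ x)))

  ^-+ : ∀ x a b → x ^ (a ℕ.+ b) ≡ x ^ a * x ^ b
  ^-+ x zero b = sym (*-identityˡ _)
  ^-+ x (suc a) b = trans (cong (x *_) (^-+ x a b)) (sym (*-assoc _ _ _))

  *-^ : ∀ x y a → (x * y) ^ a ≡ x ^ a * y ^ a
  *-^ x y zero = sym (*-identityˡ 1#)
  *-^ x y (suc a) = trans (cong ((x * y) *_) (*-^ x y a))
    (solve 4 (λ x y u v → (x :* y) :* (u :* v) := (x :* u) :* (y :* v)) refl x y (x ^ a) (y ^ a))

  1^ : ∀ a → 1# ^ a ≡ 1#
  1^ zero = refl
  1^ (suc a) = trans (*-identityˡ _) (1^ a)

  ^-* : ∀ x a b → x ^ (a ℕ.* b) ≡ (x ^ a) ^ b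
  ^-* x zero b = sym (1^ b)
  ^-* x (suc a) b = trans (^-+ x b (a ℕ.* b)) (trans (cong (x ^ b *_) (^-* x a b)) (sym (*-^ x (x ^ a) b)))

  ^-comm : ∀ x a b → (x ^ a) ^ b ≡ (x ^ b) ^ a
  ^-comm x a b = trans (sym (^-* x a b)) (trans (cong (x ^_) (ℕP.*-comm a b)) (^-* x b a))

  pow-nz : ∀ {x} a → x ≢ 0# → x ^ a ≢ 0#
  pow-nz zero x≢0 = 1≢0
  pow-nz (suc a) x≢0 = mul-nz x≢0 (pow-nz a x≢0)

  0^suc : ∀ a → 0# ^ suc a ≡ 0#
  0^suc a = zeroˡ _

  module Period (x : Carrier) (m : ℕ) (x^m≡1 : x ^ suc m ≡ 1#) where
    pow-mod : ∀ a → x ^ a ≡ x ^ (a % suc m)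
    pow-mod a = begin
        x ^ a                                      ≡⟨ cong (x ^_) (m≡m%n+[m/n]*n a (suc m)) ⟩
        x ^ (a % suc m ℕ.+ (a / suc m) ℕ.* suc m)  ≡⟨ ^-+ x (a % suc m) ((a / suc m) ℕ.* suc m) ⟩
        x ^ (a % suc m) * x ^ ((a / suc m) ℕ.* suc m)
          ≡⟨ cong (x ^ (a % suc m) *_) (trans (cong (x ^_) (ℕP.*-comm (a / suc m) (suc m))) (^-* x (suc m) (a / suc m))) ⟩
        x ^ (a % suc m) * (x ^ suc m) ^ (a / suc m) ≡⟨ cong (λ z → x ^ (a % suc m) * z ^ (a / suc m)) x^m≡1 ⟩
        x ^ (a % suc m) * 1# ^ (a / suc m)          ≡⟨ cong (x ^ (a % suc m) *_) (1^ (a / suc m)) ⟩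
        x ^ (a % suc m) * 1#                        ≡⟨ *-identityʳ _ ⟩
        x ^ (a % suc m)                             ∎
      where open ≡-Reasoning

    pow-cong-mod : ∀ a b → a % suc m ≡ b % suc m → x ^ a ≡ x ^ b
    pow-cong-mod a b e = trans (pow-mod a) (trans (cong (x ^_) e) (sym (pow-mod b)))

  NoSmallerPeriod : Carrier → ℕ → Set
  NoSmallerPeriod x m = ∀ e → 0 ℕ.< e → e ℕ.< m → x ^ e ≢ 1#

  pow-injective-below : ∀ x m → x ≢ 0# → NoSmallerPeriod x m →
                        ∀ u v → u ℕ.< v → v ℕ.< m → x ^ u ≢ x ^ v
  pow-injective-below x m x≢0 minimal u v u<v v<m e =
    minimal (v ℕ.∸ u) (ℕP.m<n⇒0<n∸m u<v) (ℕP.≤-<-trans (ℕP.m∸n≤m v u) v<m)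
      (sym (cancelˡ (pow-nz u x≢0) (trans (*-identityʳ _) (trans e
        (trans (cong (x ^_) (sym (ℕP.m+[n∸m]≡n (ℕP.<⇒≤ u<v)))) (^-+ x u (v ℕ.∸ u)))))))

  pow-injective-mod : ∀ x m → x ≢ 0# → x ^ suc m ≡ 1# → NoSmallerPeriod x (suc m) →
                      ∀ a b → x ^ a ≡ x ^ b → a % suc m ≡ b % suc m
  pow-injective-mod x m x≢0 x^m≡1 minimal a b e with ℕP.<-cmp (a % suc m) (b % suc m)
  ... | tri≈ _ eq _ = eq
  ... | tri< lt _ _ = ⊥-elim (pow-injective-below x (suc m) x≢0 minimal _ _ lt (m%n<n b (suc m))
                        (trans (sym (pow-mod a)) (trans e (pow-mod b))))
    where open Period x m x^m≡1
  ... | tri> _ _ gt = ⊥-elim (pow-injective-below x (suc m) x≢0 minimal _ _ gt (m%n<n a (suc m))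
                        (trans (sym (pow-mod b)) (trans (sym e) (pow-mod a))))
    where open Period x m x^m≡1

module FiniteField (F : Field) (N : ℕ) (bij : Field.Carrier F ↔ Fin (suc N)) where
  open import Data.Nat as ℕ using (zero; suc)
  import Data.Nat.Properties as ℕP
  open import Data.Nat.DivMod using (_%_; m%n<n)
  open import Data.Product using (proj₁; proj₂)
  open import Data.Sum using (inj₁; inj₂)
  open import Data.Empty using (⊥; ⊥-elim)
  open import Relation.Nullary using (yes; no)
  open import Relation.Binary.Definitions using (DecidableEquality)
  open import Relation.Binary.PropositionalEquality
  open import Function.Bundles using (Inverse)
  open import Data.Fin as Fin using (toℕ; punchOut; punchIn)
  import Data.Fin.Properties as FinP
  open import Data.Fin.Permutation using (Permutation; permutation)
  open import Algebra.Bundles using (CommutativeRing)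
  open Field F
  open FieldLemmas F
  open Inverse bij

  to-injective : ∀ {x y} → to x ≡ to y → x ≡ y
  to-injective {x} {y} e = trans (sym (strictlyInverseʳ x)) (trans (cong from e) (strictlyInverseʳ y))

  _≟_ : DecidableEquality Carrier
  x ≟ y with to x FinP.≟ to y
  ... | yes e = yes (to-injective e)
  ... | no ne = no (λ e → ne (cong to e))

  -- Summing all elements before and after the translation x ↦ x + 1 shows
  -- that |F| · 1 = 0.
  characteristic : natF (suc N) ≡ 0#
  characteristic = sym (+-cancelˡ (trans (+-identityʳ _) sum-translated))
    where
    open import Algebra.Properties.CommutativeMonoid.Sum (CommutativeRing.+-commutativeMonoid commutativeRing)
      using (sum; sum-permute; ∑-distrib-+; sum-cong-≗; sum-replicate)
    open import Algebra.Properties.Semiring.Mult.TCOptimised (CommutativeRing.semiring commutativeRing)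
      using (×ᵤ≈×)
    translation : Permutation (suc N) (suc N)
    translation = permutation (λ i → to (from i + 1#)) (λ i → to (from i - 1#))
      (λ i → trans (cong to (trans (cong (_+ 1#) (strictlyInverseʳ _)) (x-y+y _ _))) (strictlyInverseˡ i))
      (λ i → trans (cong to (trans (cong (_- 1#) (strictlyInverseʳ _)) (x+y-y _ _))) (strictlyInverseˡ i))
    sum-translated : sum from ≡ sum from + natF (suc N)
    sum-translated = begin
      sum from                                ≡⟨ sum-permute from translation ⟩
      sum (λ i → from (to (from i + 1#)))     ≡⟨ sum-cong-≗ (λ i → strictlyInverseʳ (from i + 1#)) ⟩
      sum (λ i → from i + 1#)                 ≡⟨ ∑-distrib-+ from (λ _ → 1#) ⟩
      sum from + sum {suc N} (λ _ → 1#)       ≡⟨ cong (sum from +_) (trans (sum-replicate (suc N)) (×ᵤ≈× (suc N) 1#)) ⟩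
      sum from + natF (suc N)                 ∎
      where open ≡-Reasoning
    +-cancelˡ : ∀ {a b c} → a + b ≡ a + c → b ≡ c
    +-cancelˡ {a} {b} {c} e = +-cancelʳ (trans (+-comm b a) (trans e (+-comm a c)))

  mul-zero : ∀ {x y} → x * y ≡ 0# → x ≡ 0# ⊎ y ≡ 0#
  mul-zero {x} {y} xy≡0 with x ≟ 0#
  ... | yes x≡0 = inj₁ x≡0
  ... | no x≢0 = inj₂ (cancelˡ x≢0 (trans xy≡0 (sym (zeroʳ x))))

  pow-zero : ∀ {x} a → x ^ a ≡ 0# → x ≡ 0#
  pow-zero {x} a x^a≡0 with x ≟ 0#
  ... | yes x≡0 = x≡0
  ... | no x≢0 = ⊥-elim (pow-nz a x≢0 x^a≡0)

  square-one : ∀ {y} → y * y ≡ 1# → y ≡ 1# ⊎ y ≡ - 1#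
  square-one {y} y²≡1 with mul-zero {y - 1#} {y + 1#} factored
    where
    factored : (y - 1#) * (y + 1#) ≡ 0#
    factored = begin
      (y - 1#) * (y + 1#)  ≡⟨ solve 1 (λ y → (y :- :1) :* (y :+ :1) := (y :* y) :- :1) refl y ⟩
      y * y - 1#           ≡⟨ cong (_- 1#) y²≡1 ⟩
      1# - 1#              ≡⟨ -‿inverseʳ 1# ⟩
      0#                   ∎
      where open ≡-Reasoning
  ... | inj₁ y-1≡0 = inj₁ (sub≡0 y-1≡0)
  ... | inj₂ y+1≡0 = inj₂ (trans (sym (x+y-y y 1#)) (trans (cong (_- 1#) y+1≡0) (+-identityˡ _)))

  module PrimitiveElement (ω : Carrier) (generates : ∀ x → x ≢ 0# → ∃ λ (i : ℕ) → ω ^ i ≡ x) where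

    primitive-nonzero : ∀ x → x ≢ 0# → x ≢ 1# → ω ≢ 0#
    primitive-nonzero x x≢0 x≢1 ω≡0 with generates x x≢0
    ... | zero , ω⁰≡x = x≢1 (sym ω⁰≡x)
    ... | suc i , ω^i≡x = x≢0 (trans (sym ω^i≡x) (trans (cong (λ z → z ^ suc i) ω≡0) (0^suc i)))

    module _ (ω≢0 : ω ≢ 0#) where
      nonzero-element : Fin N → Carrier
      nonzero-element k = from (punchIn (to 0#) k)

      nonzero-element≢0 : ∀ k → nonzero-element k ≢ 0#
      nonzero-element≢0 k e = FinP.punchInᵢ≢i (to 0#) k (trans (sym (strictlyInverseˡ _)) (cong to e))

      log : Fin N → ℕ
      log k = proj₁ (generates (nonzero-element k) (nonzero-element≢0 k))

      -- ω^(m+1) = 1 forces N ≤ m + 1: otherwise two of the N nonzero elements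
      -- would have logarithms congruent mod m + 1
      period-bound : ∀ m → ω ^ suc m ≡ 1# → N ℕ.≤ suc m
      period-bound m ω^m≡1 with N ℕ.≤? suc m
      ... | yes N≤m = N≤m
      ... | no N≰m = ⊥-elim (collision (FinP.pigeonhole (ℕP.≰⇒> N≰m) residue))
        where
        open Period ω m ω^m≡1
        residue : Fin N → Fin (suc m)
        residue k = Fin.fromℕ< (m%n<n (log k) (suc m))
        collision : (∃ λ i → ∃ λ j → i Fin.< j × residue i ≡ residue j) → ⊥
        collision (i , j , i<j , e) = ℕP.<-irrefl (cong toℕ i≡j) i<j
          where
          same-residue : log i % suc m ≡ log j % suc m
          same-residue = trans (sym (FinP.toℕ-fromℕ< _)) (trans (cong toℕ e) (FinP.toℕ-fromℕ< _))
          same-element : nonzero-element i ≡ nonzero-element j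
          same-element = trans (sym (proj₂ (generates _ _)))
            (trans (pow-cong-mod (log i) (log j) same-residue) (proj₂ (generates _ _)))
          i≡j : i ≡ j
          i≡j = FinP.punchIn-injective (to 0#) i j
            (trans (sym (strictlyInverseˡ _)) (trans (cong to same-element) (strictlyInverseˡ _)))

      -- ω^0, …, ω^N are N + 1 values among N nonzero elements; a collision
      -- ω^i = ω^j (i < j) gives ω^(j-i) = 1 with j - i ≤ N, hence j - i = N
      power≢0 : ∀ (i : Fin (suc N)) → to 0# ≢ to (ω ^ toℕ i)
      power≢0 i e = pow-nz (toℕ i) ω≢0 (sym (to-injective e))

      power-code : Fin (suc N) → Fin N
      power-code i = punchOut (power≢0 i)

      power-code-injective : ∀ (i j : Fin (suc N)) → power-code i ≡ power-code j → ω ^ toℕ i ≡ ω ^ toℕ j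
      power-code-injective i j e = to-injective (FinP.punchOut-injective (power≢0 i) (power≢0 j) e)

      ω^N≡1 : ω ^ N ≡ 1#
      ω^N≡1 with FinP.pigeonhole (ℕP.n<1+n N) power-code
      ... | i , j , i<j , e = subst (λ d → ω ^ d ≡ 1#) d≡N ω^d≡1
        where
        d : ℕ
        d = toℕ j ℕ.∸ toℕ i
        ω^d≡1 : ω ^ d ≡ 1#
        ω^d≡1 = sym (cancelˡ (pow-nz (toℕ i) ω≢0) (trans (*-identityʳ _)
                  (trans (power-code-injective i j e)
                  (trans (cong (ω ^_) (sym (ℕP.m+[n∸m]≡n (ℕP.<⇒≤ i<j)))) (^-+ ω (toℕ i) d)))))
        period-is-N : ∀ d → 0 ℕ.< d → ω ^ d ≡ 1# → d ℕ.≤ N → d ≡ N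
        period-is-N (suc d') _ ω^d≡1 d≤N = ℕP.≤-antisym d≤N (period-bound d' ω^d≡1)
        d≡N : d ≡ N
        d≡N = period-is-N d (ℕP.m<n⇒0<n∸m i<j) ω^d≡1
                (ℕP.≤-trans (ℕP.m∸n≤m (toℕ j) (toℕ i)) (ℕP.≤-pred (FinP.toℕ<n j)))

      ω-order : NoSmallerPeriod ω N
      ω-order (suc e) _ e<N ω^e≡1 = ℕP.<-irrefl refl (ℕP.<-≤-trans e<N (period-bound e ω^e≡1))

module Frobenius (F : Field) (p' : ℕ) (p-prime : Prime (suc p')) (char-p : FieldLemmas.natF F (suc p') ≡ Field.0# F) where
  open import Data.Nat as ℕ using (zero; suc)
  import Data.Nat.Properties as ℕP
  open import Data.Nat.Divisibility using (divides)
  open import Data.Nat.Combinatorics using (_C_; nCn≡1)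
  open import Data.Fin as Fin using (toℕ; inject₁; fromℕ)
  import Data.Fin.Properties as FinP
  open import Relation.Binary.PropositionalEquality
  open import Algebra.Bundles using (CommutativeRing)
  open Field F
  open FieldLemmas F
  open NatFacts using (prime∣binomial)
  private
    R : CommutativeRing _ _
    R = commutativeRing
  open import Algebra.Properties.CommutativeSemiring.Binomial (CommutativeRing.commutativeSemiring R)
    using (theorem)
  open import Algebra.Properties.Semiring.Exp (CommutativeRing.semiring R) using () renaming (_^_ to _^ₛ_)
  open import Algebra.Properties.Semiring.Mult (CommutativeRing.semiring R) using (×-assoc-*) renaming (_×_ to _×ₛ_)
  open import Algebra.Properties.Semiring.Mult.TCOptimised (CommutativeRing.semiring R) using (×ᵤ≈×; ×1-homo-*)
  open import Algebra.Properties.Semiring.Sum (CommutativeRing.semiring R)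
    using (sum; sum-init-last; sum-cong-≗; sum-replicate-zero)

  p : ℕ
  p = suc p'

  ^≡^ₛ : ∀ x k → x ^ k ≡ x ^ₛ k
  ^≡^ₛ x zero = refl
  ^≡^ₛ x (suc k) = cong (x *_) (^≡^ₛ x k)

  multiple-of-p : ∀ c z → (c ℕ.* p) ×ₛ z ≡ 0#
  multiple-of-p c z = begin
      (c ℕ.* p) ×ₛ z           ≡⟨ sym (cong ((c ℕ.* p) ×ₛ_) (*-identityˡ z)) ⟩
      (c ℕ.* p) ×ₛ (1# * z)    ≡⟨ sym (×-assoc-* (c ℕ.* p) 1# z) ⟩
      ((c ℕ.* p) ×ₛ 1#) * z    ≡⟨ cong (_* z) (×ᵤ≈× (c ℕ.* p) 1#) ⟩
      natF (c ℕ.* p) * z       ≡⟨ cong (_* z) (×1-homo-* c p) ⟩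
      natF c * natF p * z      ≡⟨ cong (λ u → natF c * u * z) char-p ⟩
      natF c * 0# * z          ≡⟨ cong (_* z) (zeroʳ (natF c)) ⟩
      0# * z                   ≡⟨ zeroˡ z ⟩
      0#                       ∎
    where open ≡-Reasoning

  -- (x + y)^p = x^p + y^p: all inner binomial coefficients are multiples of p
  frobenius : ∀ x y → (x + y) ^ p ≡ x ^ p + y ^ p
  frobenius x y = begin
      (x + y) ^ p                                ≡⟨ ^≡^ₛ (x + y) p ⟩
      (x + y) ^ₛ p                               ≡⟨ theorem p x y ⟩
      term Fin.zero + sum (λ i → term (Fin.suc i)) ≡⟨ cong (term Fin.zero +_) (sum-init-last (λ i → term (Fin.suc i))) ⟩
      term Fin.zero + (sum (λ i → term (Fin.suc (inject₁ i))) + term (fromℕ p))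
        ≡⟨ cong (λ u → term Fin.zero + (u + term (fromℕ p))) (trans (sum-cong-≗ inner-vanishes) (sum-replicate-zero p')) ⟩
      term Fin.zero + (0# + term (fromℕ p))      ≡⟨ cong (term Fin.zero +_) (+-identityˡ _) ⟩
      term Fin.zero + term (fromℕ p)             ≡⟨ +-comm _ _ ⟩
      term (fromℕ p) + term Fin.zero             ≡⟨ cong₂ _+_ last-term first-term ⟩
      x ^ p + y ^ p                              ∎
    where
    open ≡-Reasoning
    term : Fin (suc p) → Carrier
    term k = (p C toℕ k) ×ₛ ((x ^ₛ toℕ k) * (y ^ₛ (p ℕ.∸ toℕ k)))
    inner-vanishes : ∀ i → term (Fin.suc (inject₁ i)) ≡ 0#
    inner-vanishes i with prime∣binomial p-prime (suc (toℕ (inject₁ i))) (ℕ.s≤s ℕ.z≤n)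
                            (ℕ.s≤s (subst (ℕ._< p') (sym (FinP.toℕ-inject₁ i)) (FinP.toℕ<n i)))
    ... | divides c C≡cp = trans (cong (λ m → m ×ₛ monomial) C≡cp) (multiple-of-p c monomial)
      where
      k : ℕ
      k = toℕ (Fin.suc (inject₁ i))
      monomial : Carrier
      monomial = (x ^ₛ k) * (y ^ₛ (p ℕ.∸ k))
    first-term : term Fin.zero ≡ y ^ p
    first-term = trans (+-identityʳ _) (trans (*-identityˡ _) (sym (^≡^ₛ y p)))
    last-term : term (fromℕ p) ≡ x ^ p
    last-term = begin
      (p C toℕ (fromℕ p)) ×ₛ ((x ^ₛ toℕ (fromℕ p)) * (y ^ₛ (p ℕ.∸ toℕ (fromℕ p))))
        ≡⟨ cong (λ k → (p C k) ×ₛ ((x ^ₛ k) * (y ^ₛ (p ℕ.∸ k)))) (FinP.toℕ-fromℕ p) ⟩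
      (p C p) ×ₛ ((x ^ₛ p) * (y ^ₛ (p ℕ.∸ p)))   ≡⟨ cong (λ c → c ×ₛ ((x ^ₛ p) * (y ^ₛ (p ℕ.∸ p)))) (nCn≡1 p) ⟩
      (x ^ₛ p) * (y ^ₛ (p ℕ.∸ p)) + 0#           ≡⟨ +-identityʳ _ ⟩
      (x ^ₛ p) * (y ^ₛ (p ℕ.∸ p))                ≡⟨ cong (λ k → (x ^ₛ p) * (y ^ₛ k)) (ℕP.n∸n≡0 p) ⟩
      (x ^ₛ p) * 1#                              ≡⟨ *-identityʳ _ ⟩
      x ^ₛ p                                     ≡⟨ sym (^≡^ₛ x p) ⟩
      x ^ p                                      ∎

  frobenius-power : ∀ j x y → (x + y) ^ (p ℕ.^ j) ≡ x ^ (p ℕ.^ j) + y ^ (p ℕ.^ j)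
  frobenius-power zero x y = trans (*-identityʳ _) (sym (cong₂ _+_ (*-identityʳ x) (*-identityʳ y)))
  frobenius-power (suc j) x y = begin
      (x + y) ^ (p ℕ.* p ℕ.^ j)                   ≡⟨ ^-* (x + y) p (p ℕ.^ j) ⟩
      ((x + y) ^ p) ^ (p ℕ.^ j)                   ≡⟨ cong (_^ (p ℕ.^ j)) (frobenius x y) ⟩
      (x ^ p + y ^ p) ^ (p ℕ.^ j)                 ≡⟨ frobenius-power j (x ^ p) (y ^ p) ⟩
      (x ^ p) ^ (p ℕ.^ j) + (y ^ p) ^ (p ℕ.^ j)   ≡⟨ sym (cong₂ _+_ (^-* x p (p ℕ.^ j)) (^-* y p (p ℕ.^ j))) ⟩
      x ^ (p ℕ.* p ℕ.^ j) + y ^ (p ℕ.* p ℕ.^ j)   ∎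
    where open ≡-Reasoning

module SquareField (p' k T' : ℕ) (p-prime : Prime (suc p')) (F : Field)
    (n≡p^k+1 : suc (2 *ℕ suc T') ≡ suc p' ^ℕ suc k)
    (bij : Field.Carrier F ↔ Fin (suc (2 *ℕ suc T') *ℕ suc (2 *ℕ suc T')))
    (ω : Field.Carrier F) (ω-primitive : Setup.Primitive F (suc (2 *ℕ suc T')) ω) where
  open import Data.Nat as ℕ using (zero)
  import Data.Nat.Properties as ℕP
  open import Data.Nat.DivMod using (_%_; _/_; m%n<n; m<n⇒m%n≡m; m/n*n≡m; n%n≡0)
  open import Data.Fin as Fin using (toℕ)
  import Data.Fin.Properties as FinP
  open import Data.Nat.Divisibility using (_∣_; divides; m%n≡0⇒n∣m; *-cancelʳ-∣)
  open import Data.Product using (proj₁; proj₂)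
  open import Data.Sum using (inj₁; inj₂; [_,_]′; reduce) renaming (map to ⊎-map)
  open import Data.Empty using (⊥-elim)
  open import Relation.Nullary using (yes; no)
  open import Relation.Binary.PropositionalEquality
  open import Algebra.Bundles using (CommutativeRing)
  open NatFacts using (injective⇒surjective; even-or-odd; half-odd-successor; odd-square-pred; double-both)

  T n p : ℕ
  T = suc T'
  n = suc (2 ℕ.* T)
  p = suc p'

  -- |F^*| = N = q - 1, and the order 2(n - 1) of R
  N M : ℕ
  N = 2 ℕ.* T ℕ.+ 2 ℕ.* T ℕ.* n
  M = 2 ℕ.* (2 ℕ.* T)

  open Field F
  open FieldLemmas F public
  open FiniteField F N bij public using (_≟_; characteristic; mul-zero; pow-zero; square-one)
  open Setup F n ω
  open FiniteField.PrimitiveElement F N bij ω ω-primitive using (primitive-nonzero; ω^N≡1; ω-order)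
  open import Algebra.Properties.Semiring.Mult.TCOptimised (CommutativeRing.semiring commutativeRing)
    using (×-homo-+; ×1-homo-*)

  natF-^ : ∀ a j → natF (a ℕ.^ j) ≡ natF a ^ j
  natF-^ a zero = refl
  natF-^ a (suc j) = trans (×1-homo-* a (a ℕ.^ j)) (cong (natF a *_) (natF-^ a j))

  -- n · 1 = 0, as (n · 1)² = |F| · 1 = 0; hence p · 1 = 0, while 2 · 1 ≠ 0
  natF-n≡0 : natF n ≡ 0#
  natF-n≡0 = reduce (mul-zero (trans (sym (×1-homo-* n n)) characteristic))

  char-p : natF p ≡ 0#
  char-p = pow-zero (suc k) (trans (sym (natF-^ p (suc k))) (trans (cong natF (sym n≡p^k+1)) natF-n≡0))

  2≢0 : natF 2 ≢ 0#
  2≢0 2≡0 = 1≢0 (begin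
      1#                          ≡⟨ sym (+-identityʳ 1#) ⟩
      1# + 0#                     ≡⟨ cong (1# +_) (sym (zeroˡ (natF T))) ⟩
      1# + 0# * natF T            ≡⟨ cong (λ z → 1# + z * natF T) (sym 2≡0) ⟩
      1# + natF 2 * natF T        ≡⟨ cong (1# +_) (sym (×1-homo-* 2 T)) ⟩
      1# + natF (2 ℕ.* T)         ≡⟨ sym (×-homo-+ 1# 1 (2 ℕ.* T)) ⟩
      natF n                      ≡⟨ natF-n≡0 ⟩
      0#                          ∎)
    where open ≡-Reasoning

  open Frobenius F p' p-prime char-p using (frobenius-power)

  ^n-+ : ∀ x y → (x + y) ^ n ≡ x ^ n + y ^ n
  ^n-+ x y = subst (λ m → (x + y) ^ m ≡ x ^ m + y ^ m) (sym n≡p^k+1) (frobenius-power (suc k) x y)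

  ^n-neg : ∀ x → (- x) ^ n ≡ - (x ^ n)
  ^n-neg x = neg-unique (trans (sym (^n-+ x (- x))) (trans (cong (_^ n) (-‿inverseʳ x)) (0^suc (2 ℕ.* T))))

  ^n-sub : ∀ x y → (x - y) ^ n ≡ x ^ n - y ^ n
  ^n-sub x y = trans (^n-+ x (- y)) (cong (x ^ n +_) (^n-neg y))

  -1≢1 : - 1# ≢ 1#
  -1≢1 e = 2≢0 (trans (cong (_+ 1#) (sym e)) (-‿inverseˡ 1#))

  ω≢0 : ω ≢ 0#
  ω≢0 = primitive-nonzero (- 1#) -1≢0 -1≢1

  r≡T+1 : r ≡ suc T
  r≡T+1 = half-odd-successor T

  N≡r*M : N ≡ r ℕ.* M
  N≡r*M = trans (odd-square-pred T) (cong (ℕ._* M) (sym r≡T+1))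

  N≡2r*2T : N ≡ (2 ℕ.* r) ℕ.* (2 ℕ.* T)
  N≡2r*2T = trans N≡r*M (double-both r (2 ℕ.* T))

  s : Carrier
  s = ω ^ r

  s≢0 : s ≢ 0#
  s≢0 = pow-nz r ω≢0

  s^M≡1 : s ^ M ≡ 1#
  s^M≡1 = trans (sym (^-* ω r M)) (trans (cong (ω ^_) (sym N≡r*M)) (ω^N≡1 ω≢0))

  s-order : NoSmallerPeriod s M
  s-order e 0<e e<M s^e≡1 = ω-order ω≢0 (r ℕ.* e) 0<re re<N (trans (^-* ω r e) s^e≡1)
    where
    0<re : 0 ℕ.< r ℕ.* e
    0<re = subst (λ z → 0 ℕ.< z ℕ.* e) (sym r≡T+1) (ℕP.<-≤-trans 0<e (ℕP.m≤n*m e (suc T)))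
    re<N : r ℕ.* e ℕ.< N
    re<N = subst (r ℕ.* e ℕ.<_) (sym N≡r*M) (ℕP.*-monoʳ-< r {{subst ℕ.NonZero (sym r≡T+1) _}} e<M)

  ω-period-divides : ∀ a → ω ^ a ≡ 1# → N ∣ a
  ω-period-divides a ω^a≡1 = m%n≡0⇒n∣m a N
    (pow-injective-mod ω (N ℕ.∸ 1) ω≢0 (ω^N≡1 ω≢0) (ω-order ω≢0) a 0 ω^a≡1)

  -- s^(n-1) = -1, since it squares to 1 and differs from 1
  s^2T≡-1 : s ^ (2 ℕ.* T) ≡ - 1#
  s^2T≡-1 = [ (λ s^2T≡1 → ⊥-elim (s-order (2 ℕ.* T) (ℕ.s≤s ℕ.z≤n) 2T<M s^2T≡1)) , (λ s^2T≡-1 → s^2T≡-1) ]′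
              (square-one s^2T-squared)
    where
    2T<M : 2 ℕ.* T ℕ.< M
    2T<M = ℕP.m<m+n (2 ℕ.* T) {2 ℕ.* T ℕ.+ 0} (ℕ.s≤s ℕ.z≤n)
    s^2T-squared : s ^ (2 ℕ.* T) * s ^ (2 ℕ.* T) ≡ 1#
    s^2T-squared = trans (sym (^-+ s (2 ℕ.* T) (2 ℕ.* T)))
                     (trans (cong (λ z → s ^ (2 ℕ.* T ℕ.+ z)) (sym (ℕP.+-identityʳ (2 ℕ.* T)))) s^M≡1)

  s^n≡-s : s ^ n ≡ - s
  s^n≡-s = trans (cong (s *_) s^2T≡-1) (trans (sym (-‿distribʳ-* s 1#)) (cong -_ (*-identityʳ s)))

  E : Carrier → Set
  E = InFn

  E0 : E 0#
  E0 = 0^suc (2 ℕ.* T)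

  E1 : E 1#
  E1 = 1^ n

  E- : ∀ {a b} → E a → E b → E (a - b)
  E- {a} {b} a∈E b∈E = trans (^n-sub a b) (cong₂ _-_ a∈E b∈E)

  E* : ∀ {a b} → E a → E b → E (a * b)
  E* {a} {b} a∈E b∈E = trans (*-^ a b n) (cong₂ _*_ a∈E b∈E)

  E^ : ∀ {a} → E a → ∀ j → E (a ^ j)
  E^ {a} a∈E j = trans (^-comm a j n) (cong (_^ j) a∈E)

  E-inv : ∀ {a} → E a → (a≢0 : a ≢ 0#) → E (inv a a≢0)
  E-inv {a} a∈E a≢0 = cancelʳ a≢0 (begin
      inv a a≢0 ^ n * a      ≡⟨ cong (inv a a≢0 ^ n *_) (sym a∈E) ⟩
      inv a a≢0 ^ n * a ^ n  ≡⟨ sym (*-^ (inv a a≢0) a n) ⟩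
      (inv a a≢0 * a) ^ n    ≡⟨ cong (_^ n) (inv-l a a≢0) ⟩
      1# ^ n                 ≡⟨ 1^ n ⟩
      1#                     ≡⟨ sym (inv-l a a≢0) ⟩
      inv a a≢0 * a          ∎)
    where open ≡-Reasoning

  E-div : ∀ {a b} → E a → E b → (a≢0 : a ≢ 0#) → E (inv a a≢0 * b)
  E-div a∈E b∈E a≢0 = E* (E-inv a∈E a≢0) b∈E

  -- s ∉ E, but s² ∈ E, since s^n = -s
  s² : Carrier
  s² = s * s

  s²∈E : E s²
  s²∈E = trans (*-^ s s n) (trans (cong₂ _*_ s^n≡-s s^n≡-s) (solve 1 (λ s → (:- s) :* (:- s) := s :* s) refl s))

  s∉E : ¬ E s
  s∉E s∈E = x≢-x 2≢0 s s≢0 (trans (sym s∈E) s^n≡-s)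

  E-cancel : ∀ {b x c} → E b → E c → (b≢0 : b ≢ 0#) → b * x ≡ c → E x
  E-cancel {b} {x} b∈E c∈E b≢0 bx≡c = subst E (solve-linear b≢0 bx≡c) (E-div b∈E c∈E b≢0)

  R1 : InR 1#
  R1 = 0 , refl

  R* : ∀ {a b} → InR a → InR b → InR (a * b)
  R* (i , a≡s^i) (j , b≡s^j) = i ℕ.+ j , trans (cong₂ _*_ a≡s^i b≡s^j) (sym (^-+ s i j))

  R≢0 : ∀ {a} → InR a → a ≢ 0#
  R≢0 (i , a≡s^i) a≡0 = pow-nz i s≢0 (trans (sym a≡s^i) a≡0)

  R-inverse : ∀ {a} → InR a → ∃ λ b → InR b × a * b ≡ 1#
  R-inverse {a} (i , a≡s^i) = s ^ (i ℕ.* (M ℕ.∸ 1)) , (i ℕ.* (M ℕ.∸ 1) , refl) , (begin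
      a * s ^ (i ℕ.* (M ℕ.∸ 1))                ≡⟨ cong (_* s ^ (i ℕ.* (M ℕ.∸ 1))) a≡s^i ⟩
      s ^ i * s ^ (i ℕ.* (M ℕ.∸ 1))            ≡⟨ sym (^-+ s i (i ℕ.* (M ℕ.∸ 1))) ⟩
      s ^ (i ℕ.+ i ℕ.* (M ℕ.∸ 1))              ≡⟨ cong (s ^_) (sym (ℕP.*-suc i (M ℕ.∸ 1))) ⟩
      s ^ (i ℕ.* M)                             ≡⟨ cong (s ^_) (ℕP.*-comm i M) ⟩
      s ^ (M ℕ.* i)                             ≡⟨ ^-* s M i ⟩
      (s ^ M) ^ i                               ≡⟨ cong (_^ i) s^M≡1 ⟩
      1# ^ i                                    ≡⟨ 1^ i ⟩
      1#                                        ∎)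
    where open ≡-Reasoning

  R-1 : InR (- 1#)
  R-1 = 2 ℕ.* T , sym s^2T≡-1

  s^2j≡s²^j : ∀ j → s ^ (2 ℕ.* j) ≡ s² ^ j
  s^2j≡s²^j j = trans (^-* s 2 j) (cong (λ z → (s * z) ^ j) (*-identityʳ s))

  -- every element of R lies in E or in E·s (even or odd powers of s)
  R⊆E∪Es : ∀ {x} → InR x → E x ⊎ (∃ λ c → E c × x ≡ c * s)
  R⊆E∪Es {x} (i , x≡s^i) with even-or-odd i
  ... | j , inj₁ refl = inj₁ (subst E (sym (trans x≡s^i (s^2j≡s²^j j))) (E^ s²∈E j))
  ... | j , inj₂ refl = inj₂ (s² ^ j , E^ s²∈E j , trans x≡s^i (trans (cong (s *_) (s^2j≡s²^j j)) (*-comm s _)))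

  -- ω^(a(n-1)) = 1 forces 2r ∣ a, as |F^*| = 2r·(n - 1)
  2r∣exponent : ∀ a → ω ^ (a ℕ.* (2 ℕ.* T)) ≡ 1# → 2 ℕ.* r ∣ a
  2r∣exponent a ω^a2T≡1 =
    *-cancelʳ-∣ {2 ℕ.* r} {a} (2 ℕ.* T) (subst (_∣ a ℕ.* (2 ℕ.* T)) N≡2r*2T (ω-period-divides _ ω^a2T≡1))

  ω^2r-multiple∈R : ∀ a → 2 ℕ.* r ∣ a → InR (ω ^ a)
  ω^2r-multiple∈R a (divides c a≡c*2r) = 2 ℕ.* c , (begin
      ω ^ a                   ≡⟨ cong (ω ^_) (trans a≡c*2r (trans (double-both c r) (ℕP.*-comm (2 ℕ.* c) r))) ⟩
      ω ^ (r ℕ.* (2 ℕ.* c))   ≡⟨ ^-* ω r (2 ℕ.* c) ⟩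
      s ^ (2 ℕ.* c)           ∎)
    where open ≡-Reasoning

  -- conversely, E∖{0} ⊆ R: for x = ω^a ∈ E we have x^(n-1) = 1, so x is an even power of s
  E⊆R : ∀ {x} → E x → x ≢ 0# → InR x
  E⊆R {x} x∈E x≢0 = subst InR ω^a≡x (ω^2r-multiple∈R a (2r∣exponent a ω^a2T≡1))
    where
    a : ℕ
    a = proj₁ (ω-primitive x x≢0)
    ω^a≡x : ω ^ a ≡ x
    ω^a≡x = proj₂ (ω-primitive x x≢0)
    ω^a2T≡1 : ω ^ (a ℕ.* (2 ℕ.* T)) ≡ 1#
    ω^a2T≡1 = trans (^-* ω a (2 ℕ.* T)) (trans (cong (_^ (2 ℕ.* T)) ω^a≡x) (cancelˡ x≢0 (trans x∈E (sym (*-identityʳ x)))))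

  s∈R : InR s
  s∈R = 1 , sym (*-identityʳ s)

  Es⊆R : ∀ {c} → E c → c ≢ 0# → InR (c * s)
  Es⊆R c∈E c≢0 = R* (E⊆R c∈E c≢0) s∈R

  E-coordinates-unique : ∀ {u v u' v'} → E u → E v → E u' → E v' →
                         u + v * s ≡ u' + v' * s → u ≡ u' × v ≡ v'
  E-coordinates-unique {u} {v} {u'} {v'} u∈E v∈E u'∈E v'∈E e with v ≟ v'
  ... | yes v≡v' = +-cancelʳ (trans e (cong (λ z → u' + z * s) (sym v≡v'))) , v≡v'
  ... | no v≢v' = ⊥-elim (s∉E (E-cancel (E- v∈E v'∈E) (E- u'∈E u∈E) v-v'≢0 difference))
    where
    v-v'≢0 : v - v' ≢ 0#
    v-v'≢0 d = v≢v' (sub≡0 d)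
    difference : (v - v') * s ≡ u' - u
    difference = begin
      (v - v') * s                ≡⟨ solve 4 (λ u v v' s → (v :- v') :* s := (u :+ v :* s) :- (u :+ v' :* s)) refl u v v' s ⟩
      (u + v * s) - (u + v' * s)  ≡⟨ cong (_- (u + v' * s)) e ⟩
      (u' + v' * s) - (u + v' * s) ≡⟨ solve 4 (λ u u' v' s → (u' :+ v' :* s) :- (u :+ v' :* s) := u' :- u) refl u u' v' s ⟩
      u' - u                      ∎
      where open ≡-Reasoning

  R-criterion⇒ : ∀ {u v} → E u → E v → InR (u + v * s) → u ≡ 0# ⊎ v ≡ 0#
  R-criterion⇒ {u} {v} u∈E v∈E x∈R with R⊆E∪Es x∈R
  ... | inj₁ x∈E = inj₂ (proj₂ (E-coordinates-unique u∈E v∈E x∈E E0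
                     (solve 3 (λ u v s → u :+ v :* s := (u :+ v :* s) :+ :0 :* s) refl u v s)))
  ... | inj₂ (c , c∈E , x≡cs) = inj₁ (proj₁ (E-coordinates-unique u∈E v∈E E0 c∈E
                     (trans x≡cs (solve 2 (λ c s → c :* s := :0 :+ c :* s) refl c s))))

  R-criterion⇐ : ∀ {u v} → E u → E v → u + v * s ≢ 0# → u ≡ 0# ⊎ v ≡ 0# → InR (u + v * s)
  R-criterion⇐ {u} {v} u∈E v∈E x≢0 (inj₁ u≡0) = subst InR (sym x≡vs) (Es⊆R v∈E v≢0)
    where
    x≡vs : u + v * s ≡ v * s
    x≡vs = trans (cong (_+ v * s) u≡0) (+-identityˡ _)
    v≢0 : v ≢ 0#
    v≢0 v≡0 = x≢0 (trans x≡vs (trans (cong (_* s) v≡0) (zeroˡ s)))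
  R-criterion⇐ {u} {v} u∈E v∈E x≢0 (inj₂ v≡0) = subst InR (sym x≡u) (E⊆R u∈E (λ u≡0 → x≢0 (trans x≡u u≡0)))
    where
    x≡u : u + v * s ≡ u
    x≡u = trans (cong (λ z → u + z * s) v≡0) (trans (cong (u +_) (zeroˡ s)) (+-identityʳ u))

  R-factor : ∀ {ρ x} → InR ρ → InR (ρ * x) → InR x
  R-factor {ρ} {x} ρ∈R ρx∈R = subst InR ρ⁻¹ρx≡x (R* (proj₁ (proj₂ ρ⁻¹-spec)) ρx∈R)
    where
    ρ⁻¹-spec : ∃ λ ρ⁻¹ → InR ρ⁻¹ × ρ * ρ⁻¹ ≡ 1#
    ρ⁻¹-spec = R-inverse ρ∈R
    ρ⁻¹ : Carrier
    ρ⁻¹ = proj₁ ρ⁻¹-spec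
    ρ⁻¹ρx≡x : ρ⁻¹ * (ρ * x) ≡ x
    ρ⁻¹ρx≡x = trans (sym (*-assoc ρ⁻¹ ρ x)) (trans (cong (_* x) (trans (*-comm ρ⁻¹ ρ) (proj₂ (proj₂ ρ⁻¹-spec)))) (*-identityˡ x))

  coset-ratio : ∀ {β α α'} → InRcoset β α → InRcoset β α' → ∃ λ t → InR t × t * α ≡ α'
  coset-ratio {β} {α} {α'} (ρ , ρ∈R , α≡ρβ) (ρ' , ρ'∈R , α'≡ρ'β) = ρ' * ρ⁻¹ , R* ρ'∈R (proj₁ (proj₂ ρ⁻¹-spec)) , (begin
      (ρ' * ρ⁻¹) * α         ≡⟨ cong ((ρ' * ρ⁻¹) *_) α≡ρβ ⟩
      (ρ' * ρ⁻¹) * (ρ * β)   ≡⟨ solve 4 (λ a b c d → (a :* b) :* (c :* d) := a :* (c :* b) :* d) refl ρ' ρ⁻¹ ρ β ⟩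
      ρ' * (ρ * ρ⁻¹) * β     ≡⟨ cong (λ z → ρ' * z * β) (proj₂ (proj₂ ρ⁻¹-spec)) ⟩
      ρ' * 1# * β            ≡⟨ cong (_* β) (*-identityʳ ρ') ⟩
      ρ' * β                 ≡⟨ sym α'≡ρ'β ⟩
      α'                     ∎)
    where
    open ≡-Reasoning
    ρ⁻¹-spec : ∃ λ ρ⁻¹ → InR ρ⁻¹ × ρ * ρ⁻¹ ≡ 1#
    ρ⁻¹-spec = R-inverse ρ∈R
    ρ⁻¹ : Carrier
    ρ⁻¹ = proj₁ ρ⁻¹-spec

  vertex : Carrier → V
  vertex α = (α · e) ⊕ f

  vertex≡ : ∀ α → vertex α ≡ (α , 1#)
  vertex≡ α = cong₂ _,_ (trans (+-identityʳ _) (*-identityʳ α)) (trans (cong (_+ 1#) (zeroʳ α)) (+-identityˡ 1#))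

  vertex≢0 : ∀ α → NonZeroV (vertex α)
  vertex≢0 α eq = 1≢0 (cong proj₂ (trans (sym (vertex≡ α)) eq))

  B-vertices : ∀ α α' → B (vertex α) (vertex α') ≡ α - α'
  B-vertices α α' = trans (cong₂ B (vertex≡ α) (vertex≡ α')) (solve 2 (λ a a' → a :* :1 :- :1 :* a' := a :- a') refl α α')

  -- R(α, 1) = R(α', 1) only if α = α' (compare second coordinates)
  same-vertex-injective : ∀ {α α'} → SameVertex (vertex α) (vertex α') → α ≡ α'
  same-vertex-injective {α} {α'} (ρ , _ , eq) = trans (sym (*-identityˡ α)) (trans (cong (_* α) (sym ρ≡1)) (sym (cong proj₁ scaled)))
    where
    scaled : (α' , 1#) ≡ (ρ * α , ρ * 1#)
    scaled = trans (sym (vertex≡ α')) (trans eq (cong (ρ ·_) (vertex≡ α)))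
    ρ≡1 : ρ ≡ 1#
    ρ≡1 = trans (sym (*-identityʳ ρ)) (sym (cong proj₂ scaled))

  same-vertex-refl : ∀ v → SameVertex v v
  same-vertex-refl (a , b) = 1# , R1 , sym (cong₂ _,_ (*-identityˡ a) (*-identityˡ b))

  -- The key lemma.  Write β = b + c·s with b = β_ev, c·s = β_odd (b, c ∈ E),
  -- and γ = β_ev / β_odd.  For t ∈ R ∖ {1}:  (1 - t)β ∈ R  ⟺  t = γ or tγ = 1.
  module KeyLemma (β : Carrier) (β≢0 : β ≢ 0#) (β∉R : ¬ InR β)
                  (βev βodd : Carrier) (β-split : EvOdd β βev βodd)
                  (γ : Carrier) (γβodd≡βev : γ * βodd ≡ βev) where
    b c : Carrier
    b = βev
    c = proj₁ (proj₁ (proj₂ β-split))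

    b∈E : E b
    b∈E = proj₁ β-split

    c∈E : E c
    c∈E = proj₁ (proj₂ (proj₁ (proj₂ β-split)))

    βodd≡cs : βodd ≡ c * s
    βodd≡cs = proj₂ (proj₂ (proj₁ (proj₂ β-split)))

    β≡b+cs : β ≡ b + c * s
    β≡b+cs = trans (proj₂ (proj₂ β-split)) (cong (b +_) βodd≡cs)

    -- both coordinates of β are nonzero, as β ∉ R
    b≢0 : b ≢ 0#
    b≢0 b≡0 = β∉R (subst InR (sym β≡b+cs) (R-criterion⇐ b∈E c∈E (λ x≡0 → β≢0 (trans β≡b+cs x≡0)) (inj₁ b≡0)))

    c≢0 : c ≢ 0#
    c≢0 c≡0 = β∉R (subst InR (sym β≡b+cs) (R-criterion⇐ b∈E c∈E (λ x≡0 → β≢0 (trans β≡b+cs x≡0)) (inj₂ c≡0)))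

    βodd≢0 : βodd ≢ 0#
    βodd≢0 βodd≡0 = mul-nz c≢0 s≢0 (trans (sym βodd≡cs) βodd≡0)

    γ≢0 : γ ≢ 0#
    γ≢0 γ≡0 = b≢0 (trans (sym γβodd≡βev) (trans (cong (_* βodd) γ≡0) (zeroˡ _)))

    cs²≢0 : c * s² ≢ 0#
    cs²≢0 = mul-nz c≢0 (mul-nz s≢0 s≢0)

    -- γ = u·s with u = b / (c s²) ∈ E∖{0}; hence γ ∈ R but γ ∉ E
    u : Carrier
    u = inv (c * s²) cs²≢0 * b

    u∈E : E u
    u∈E = E-div (E* c∈E s²∈E) b∈E cs²≢0

    u≢0 : u ≢ 0#
    u≢0 = mul-nz (inv≢0 _ cs²≢0) b≢0

    γ≡us : γ ≡ u * s
    γ≡us = cancelʳ βodd≢0 (begin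
        γ * βodd                         ≡⟨ γβodd≡βev ⟩
        b                                ≡⟨ sym (solve-linear cs²≢0 refl) ⟩
        inv (c * s²) cs²≢0 * (c * s² * b) ≡⟨ solve 4 (λ i c s b → i :* (c :* (s :* s) :* b) := (i :* b :* s) :* (c :* s)) refl (inv (c * s²) cs²≢0) c s b ⟩
        (u * s) * (c * s)                ≡⟨ cong ((u * s) *_) (sym βodd≡cs) ⟩
        (u * s) * βodd                   ∎)
      where open ≡-Reasoning

    γ∈R : InR γ
    γ∈R = subst InR (sym γ≡us) (Es⊆R u∈E u≢0)

    γ∉E : ¬ E γ
    γ∉E γ∈E = s∉E (E-cancel u∈E γ∈E u≢0 (sym γ≡us))

    expansion : ∀ c' → (1# - c' * s) * β ≡ (b - c' * c * s²) + (c - c' * b) * s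
    expansion c' = trans (cong ((1# - c' * s) *_) β≡b+cs)
      (solve 4 (λ c' s b c → (:1 :- c' :* s) :* (b :+ c :* s) := (b :- c' :* c :* (s :* s)) :+ (c :- c' :* b) :* s) refl c' s b c)

    first-coordinate : ∀ c' → Iff (b - c' * c * s² ≡ 0#) (c' * s ≡ γ)
    first-coordinate c' = (λ e → cancelʳ βodd≢0 (trans tβodd (trans (sym (sub≡0 e)) (sym γβodd≡βev)))) ,
                          (λ e → trans (cong (λ z → b - z) (trans (sym tβodd) (trans (cong (_* βodd) e) γβodd≡βev))) (-‿inverseʳ b))
      where
      tβodd : (c' * s) * βodd ≡ c' * c * s²
      tβodd = trans (cong ((c' * s) *_) βodd≡cs) (solve 3 (λ c' s c → (c' :* s) :* (c :* s) := c' :* c :* (s :* s)) refl c' s c)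

    second-coordinate : ∀ c' → Iff (c - c' * b ≡ 0#) ((c' * s) * γ ≡ 1#)
    second-coordinate c' = (λ e → cancelʳ βodd≢0 (trans tγβodd (trans (cong (_* s) (sym (sub≡0 e)))
                                    (trans (sym βodd≡cs) (sym (*-identityˡ βodd)))))) ,
                           (λ e → trans (cong (λ z → c - z) (sym (cancelʳ s≢0 (trans (sym βodd≡cs)
                                    (trans (sym (*-identityˡ βodd)) (trans (cong (_* βodd) (sym e)) tγβodd))))))
                                  (-‿inverseʳ c))
      where
      tγβodd : (c' * s) * γ * βodd ≡ (c' * b) * s
      tγβodd = begin
        (c' * s) * γ * βodd    ≡⟨ *-assoc _ _ _ ⟩
        (c' * s) * (γ * βodd)  ≡⟨ cong ((c' * s) *_) γβodd≡βev ⟩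
        (c' * s) * b           ≡⟨ solve 3 (λ c' s b → (c' :* s) :* b := (c' :* b) :* s) refl c' s b ⟩
        (c' * b) * s           ∎
        where open ≡-Reasoning

    1-t≢0 : ∀ {t} → t ≢ 1# → 1# - t ≢ 0#
    1-t≢0 t≢1 e = t≢1 (sym (sub≡0 e))

    key-even : ∀ {t} → E t → t ≢ 1# → ¬ InR ((1# - t) * β) × ¬ (t ≡ γ ⊎ t * γ ≡ 1#)
    key-even {t} t∈E t≢1 = not-in-R , not-γ±
      where
      not-in-R : ¬ InR ((1# - t) * β)
      not-in-R x∈R = [ mul-nz (1-t≢0 t≢1) b≢0 , mul-nz (1-t≢0 t≢1) c≢0 ]′
        (R-criterion⇒ (E* (E- E1 t∈E) b∈E) (E* (E- E1 t∈E) c∈E) (subst InR split x∈R))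
        where
        split : (1# - t) * β ≡ (1# - t) * b + ((1# - t) * c) * s
        split = trans (cong ((1# - t) *_) β≡b+cs)
          (solve 4 (λ x b c s → x :* (b :+ c :* s) := x :* b :+ (x :* c) :* s) refl (1# - t) b c s)
      not-γ± : ¬ (t ≡ γ ⊎ t * γ ≡ 1#)
      not-γ± (inj₁ t≡γ) = γ∉E (subst E t≡γ t∈E)
      not-γ± (inj₂ tγ≡1) = γ∉E (subst E (solve-linear t≢0 tγ≡1) (E-div t∈E E1 t≢0))
        where
        t≢0 : t ≢ 0#
        t≢0 t≡0 = 1≢0 (trans (sym tγ≡1) (trans (cong (_* γ) t≡0) (zeroˡ γ)))

    key-odd : ∀ {c'} → E c' → (1# - c' * s) * β ≢ 0# → Iff (InR ((1# - c' * s) * β)) (c' * s ≡ γ ⊎ (c' * s) * γ ≡ 1#)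
    key-odd {c'} c'∈E x≢0 =
      (λ x∈R → ⊎-map (proj₁ (first-coordinate c')) (proj₁ (second-coordinate c'))
                 (R-criterion⇒ coord₁∈E coord₂∈E (subst InR (expansion c') x∈R))) ,
      (λ γ± → subst InR (sym (expansion c'))
                 (R-criterion⇐ coord₁∈E coord₂∈E (λ e → x≢0 (trans (expansion c') e))
                   (⊎-map (proj₂ (first-coordinate c')) (proj₂ (second-coordinate c')) γ±)))
      where
      coord₁∈E : E (b - c' * c * s²)
      coord₁∈E = E- b∈E (E* (E* c'∈E c∈E) s²∈E)
      coord₂∈E : E (c - c' * b)
      coord₂∈E = E- c∈E (E* c'∈E b∈E)

    key-lemma : ∀ {t} → InR t → t ≢ 1# → Iff (InR ((1# - t) * β)) (t ≡ γ ⊎ t * γ ≡ 1#)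
    key-lemma {t} t∈R t≢1 with R⊆E∪Es t∈R
    ... | inj₁ t∈E = (λ x∈R → ⊥-elim (proj₁ (key-even t∈E t≢1) x∈R)) , (λ γ± → ⊥-elim (proj₂ (key-even t∈E t≢1) γ±))
    ... | inj₂ (c' , c'∈E , refl) = key-odd c'∈E (mul-nz (1-t≢0 t≢1) β≢0)

  module CommonNeighbours (β : Carrier) (β≢0 : β ≢ 0#) (β∉R : ¬ InR β)
                          (βinv : Carrier) (ββinv≡1 : β * βinv ≡ 1#)
                          (βev βodd : Carrier) (β-split : EvOdd β βev βodd)
                          (γ : Carrier) (γβodd≡βev : γ * βodd ≡ βev) where
    open KeyLemma β β≢0 β∉R βev βodd β-split γ γβodd≡βev using (γ∈R; γ∉E; γ≢0; key-lemma)

    coset≢0 : ∀ {α} → InRcoset β α → α ≢ 0#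
    coset≢0 (ρ , ρ∈R , α≡ρβ) α≡0 = mul-nz (R≢0 ρ∈R) β≢0 (trans (sym α≡ρβ) α≡0)

    ratio-condition : ∀ {t α α'} → α ≢ 0# → t * α ≡ α' →
                      Iff (t ≡ γ ⊎ t * γ ≡ 1#) (α' ≡ α * γ ⊎ α' * γ ≡ α)
    ratio-condition {t} {α} {α'} α≢0 tα≡α' = ⊎-map forward₁ forward₂ , ⊎-map backward₁ backward₂
      where
      swap : (t * α) * γ ≡ (t * γ) * α
      swap = solve 3 (λ t a g → (t :* a) :* g := (t :* g) :* a) refl t α γ
      forward₁ : t ≡ γ → α' ≡ α * γ
      forward₁ t≡γ = trans (sym tα≡α') (trans (cong (_* α) t≡γ) (*-comm γ α))
      forward₂ : t * γ ≡ 1# → α' * γ ≡ α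
      forward₂ tγ≡1 = trans (cong (_* γ) (sym tα≡α')) (trans swap (trans (cong (_* α) tγ≡1) (*-identityˡ α)))
      backward₁ : α' ≡ α * γ → t ≡ γ
      backward₁ e = cancelʳ α≢0 (trans tα≡α' (trans e (*-comm α γ)))
      backward₂ : α' * γ ≡ α → t * γ ≡ 1#
      backward₂ e = cancelʳ α≢0 (trans (sym swap) (trans (cong (_* γ) tα≡α') (trans e (sym (*-identityˡ α)))))

    adjacency : ∀ α α' → InRcoset β α → InRcoset β α' → ¬ SameVertex (vertex α) (vertex α') →
                Iff (Adj (vertex α) (vertex α')) (α' ≡ α * γ ⊎ α' * γ ≡ α)
    adjacency α α' α∈Rβ α'∈Rβ distinct =
        (λ adj → proj₁ condition (proj₁ key (R-factor ρ∈R (subst InR B≡ρ[1-t]β adj)))) ,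
        (λ γ± → subst InR (sym B≡ρ[1-t]β) (R* ρ∈R (proj₂ key (proj₂ condition γ±))))
      where
      ρ : Carrier
      ρ = proj₁ α∈Rβ
      ρ∈R : InR ρ
      ρ∈R = proj₁ (proj₂ α∈Rβ)
      α≡ρβ : α ≡ ρ * β
      α≡ρβ = proj₂ (proj₂ α∈Rβ)
      ratio : ∃ λ t → InR t × t * α ≡ α'
      ratio = coset-ratio α∈Rβ α'∈Rβ
      t : Carrier
      t = proj₁ ratio
      t∈R : InR t
      t∈R = proj₁ (proj₂ ratio)
      tα≡α' : t * α ≡ α'
      tα≡α' = proj₂ (proj₂ ratio)
      t≢1 : t ≢ 1#
      t≢1 t≡1 = distinct (subst (λ α'' → SameVertex (vertex α) (vertex α'')) α≡α' (same-vertex-refl (vertex α)))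
        where
        α≡α' : α ≡ α'
        α≡α' = trans (sym (*-identityˡ α)) (trans (cong (_* α) (sym t≡1)) tα≡α')
      key : Iff (InR ((1# - t) * β)) (t ≡ γ ⊎ t * γ ≡ 1#)
      key = key-lemma t∈R t≢1
      condition : Iff (t ≡ γ ⊎ t * γ ≡ 1#) (α' ≡ α * γ ⊎ α' * γ ≡ α)
      condition = ratio-condition (coset≢0 α∈Rβ) tα≡α'
      B≡ρ[1-t]β : B (vertex α) (vertex α') ≡ ρ * ((1# - t) * β)
      B≡ρ[1-t]β = begin
        B (vertex α) (vertex α')  ≡⟨ B-vertices α α' ⟩
        α - α'                    ≡⟨ cong (λ z → α - z) (sym tα≡α') ⟩
        α - t * α                 ≡⟨ cong (λ z → z - t * z) α≡ρβ ⟩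
        ρ * β - t * (ρ * β)       ≡⟨ solve 3 (λ r t b → r :* b :- t :* (r :* b) := r :* ((:1 :- t) :* b)) refl ρ t β ⟩
        ρ * ((1# - t) * β)        ∎
        where open ≡-Reasoning

    y : V
    y = βinv · f

    μ : V → Set
    μ = CommonNbr e y

    βinv≢0 : βinv ≢ 0#
    βinv≢0 βinv≡0 = 1≢0 (trans (sym ββinv≡1) (trans (cong (β *_) βinv≡0) (zeroʳ β)))

    B-e : ∀ a b → B e (a , b) ≡ b
    B-e a b = solve 2 (λ a b → :1 :* b :- :0 :* a := b) refl a b

    B-y : ∀ a b → B y (a , b) ≡ - 1# * (βinv * a)
    B-y a b = solve 3 (λ i a b → (i :* :0) :* b :- (i :* :1) :* a := (:- :1) :* (i :* a)) refl βinv a b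

    -- a common neighbour (a, b) of x = Re and y has b ∈ R and β⁻¹a ∈ R,
    -- so it is the vertex R(α, 1) with α = a/b ∈ Rβ
    μ⇒ : ∀ w → μ w → ∃ λ α → InRcoset β α × SameVertex (vertex α) w
    μ⇒ (a , b) (_ , e~w , y~w) = α , (ρ , ρ∈R , α≡ρβ) , (b , b∈R , w≡b·vertex)
      where
      b∈R : InR b
      b∈R = subst InR (B-e a b) e~w
      βinv-a∈R : InR (βinv * a)
      βinv-a∈R = R-factor R-1 (subst InR (B-y a b) y~w)
      b⁻¹-spec : ∃ λ b⁻¹ → InR b⁻¹ × b * b⁻¹ ≡ 1#
      b⁻¹-spec = R-inverse b∈R
      b⁻¹ : Carrier
      b⁻¹ = proj₁ b⁻¹-spec
      α ρ : Carrier
      α = a * b⁻¹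
      ρ = (βinv * a) * b⁻¹
      ρ∈R : InR ρ
      ρ∈R = R* βinv-a∈R (proj₁ (proj₂ b⁻¹-spec))
      α≡ρβ : α ≡ ρ * β
      α≡ρβ = begin
        a * b⁻¹                  ≡⟨ sym (*-identityʳ _) ⟩
        a * b⁻¹ * 1#             ≡⟨ cong (a * b⁻¹ *_) (sym ββinv≡1) ⟩
        a * b⁻¹ * (β * βinv)     ≡⟨ solve 4 (λ a c b i → a :* c :* (b :* i) := (i :* a) :* c :* b) refl a b⁻¹ β βinv ⟩
        ρ * β                    ∎
        where open ≡-Reasoning
      w≡b·vertex : (a , b) ≡ b · vertex α
      w≡b·vertex = sym (trans (cong (b ·_) (vertex≡ α)) (cong₂ _,_ bα≡a (*-identityʳ b)))
        where
        bα≡a : b * (a * b⁻¹) ≡ a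
        bα≡a = trans (solve 3 (λ b a c → b :* (a :* c) := a :* (b :* c)) refl b a b⁻¹)
                     (trans (cong (a *_) (proj₂ (proj₂ b⁻¹-spec))) (*-identityʳ a))

    -- conversely σ(α, 1) with σ ∈ R, α = ρβ ∈ Rβ is adjacent to x (B = σ)
    -- and to y (B = -σρ)
    μ⇐ : ∀ w → NonZeroV w → (∃ λ α → InRcoset β α × SameVertex (vertex α) w) → μ w
    μ⇐ w w≢0 (α , (ρ , ρ∈R , α≡ρβ) , (σ , σ∈R , w≡σ·vertex)) = w≢0 , e~w , y~w
      where
      w≡ : w ≡ (σ * α , σ * 1#)
      w≡ = trans w≡σ·vertex (cong (σ ·_) (vertex≡ α))
      e~w : Adj e w
      e~w = subst InR (sym (trans (cong (B e) w≡) (trans (B-e _ _) (*-identityʳ σ)))) σ∈R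
      B-y-w : B y w ≡ (- 1# * σ) * ρ
      B-y-w = begin
        B y w                                 ≡⟨ cong (B y) w≡ ⟩
        B y (σ * α , σ * 1#)                  ≡⟨ B-y (σ * α) (σ * 1#) ⟩
        - 1# * (βinv * (σ * α))               ≡⟨ cong (λ z → - 1# * (βinv * (σ * z))) α≡ρβ ⟩
        - 1# * (βinv * (σ * (ρ * β)))         ≡⟨ solve 4 (λ i s r b → (:- :1) :* (i :* (s :* (r :* b))) := ((:- :1) :* s) :* r :* (b :* i)) refl βinv σ ρ β ⟩
        (- 1# * σ) * ρ * (β * βinv)           ≡⟨ cong ((- 1# * σ) * ρ *_) ββinv≡1 ⟩
        (- 1# * σ) * ρ * 1#                   ≡⟨ *-identityʳ _ ⟩
        (- 1# * σ) * ρ                        ∎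
        where open ≡-Reasoning
      y~w : Adj y w
      y~w = subst InR (sym B-y-w) (R* (R* R-1 σ∈R) ρ∈R)

    μ-description : ∀ w → NonZeroV w → Iff (μ w) (∃ λ α → InRcoset β α × SameVertex (vertex α) w)
    μ-description w w≢0 = μ⇒ w , μ⇐ w w≢0

    β∈Rβ : InRcoset β β
    β∈Rβ = 1# , R1 , sym (*-identityˡ β)

    distance-two : Dist2 e y
    distance-two = x≠y , x≁y , vertex β , vertex≢0 β , proj₁ (proj₂ common) , β~y
      where
      x≠y : ¬ SameVertex e y
      x≠y (ρ , _ , e≡ρy) = βinv≢0 (trans (sym (*-identityʳ βinv)) (trans (cong proj₂ e≡ρy) (zeroʳ ρ)))
      x≁y : ¬ Adj e y
      x≁y e~y = β∉R (subst InR inverse≡β (proj₁ (proj₂ βinv⁻¹-spec)))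
        where
        βinv∈R : InR βinv
        βinv∈R = subst InR (trans (B-e _ _) (*-identityʳ βinv)) e~y
        βinv⁻¹-spec : ∃ λ z → InR z × βinv * z ≡ 1#
        βinv⁻¹-spec = R-inverse βinv∈R
        inverse≡β : proj₁ βinv⁻¹-spec ≡ β
        inverse≡β = sym (cancelˡ βinv≢0 (trans (*-comm βinv β) (trans ββinv≡1 (sym (proj₂ (proj₂ βinv⁻¹-spec))))))
      common : μ (vertex β)
      common = μ⇐ (vertex β) (vertex≢0 β) (β , β∈Rβ , same-vertex-refl (vertex β))
      β~y : Adj (vertex β) y
      β~y = subst InR (sym (trans (cong (λ v → B v y) (vertex≡ β))
              (trans (solve 2 (λ b i → b :* (i :* :1) :- :1 :* (i :* :0) := b :* i) refl β βinv) ββinv≡1))) R1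

    μ-size : HasSize μ M
    μ-size = listing , (λ i → vertex≢0 _ , μ⇐ (listing i) (vertex≢0 _) (_ , (s ^ toℕ i , (toℕ i , refl) , refl) , same-vertex-refl _)) ,
             listing-injective , listing-covers
      where
      listing : Fin M → V
      listing i = vertex (s ^ toℕ i * β)
      listing-injective : ∀ i j → SameVertex (listing i) (listing j) → i ≡ j
      listing-injective i j same = FinP.toℕ-injective
          (trans (sym (m<n⇒m%n≡m (FinP.toℕ<n i))) (trans i≡j-mod-M (m<n⇒m%n≡m (FinP.toℕ<n j))))
        where
        i≡j-mod-M : toℕ i % M ≡ toℕ j % M
        i≡j-mod-M = pow-injective-mod s (M ℕ.∸ 1) s≢0 s^M≡1 s-order (toℕ i) (toℕ j)
                      (cancelʳ β≢0 (same-vertex-injective same))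
      listing-covers : ∀ w → NonZeroV w → μ w → ∃ λ i → SameVertex (listing i) w
      listing-covers w w≢0 w∈μ = covered (μ⇒ w w∈μ)
        where
        covered : (∃ λ α → InRcoset β α × SameVertex (vertex α) w) → ∃ λ i → SameVertex (listing i) w
        covered (α , (ρ , (a , ρ≡s^a) , α≡ρβ) , same) = Fin.fromℕ< (m%n<n a M) , subst (λ v → SameVertex v w) (cong vertex (sym α≡)) same
          where
          α≡ : s ^ toℕ (Fin.fromℕ< (m%n<n a M)) * β ≡ α
          α≡ = trans (cong (λ z → s ^ z * β) (FinP.toℕ-fromℕ< (m%n<n a M)))
                 (trans (cong (_* β) (sym (Period.pow-mod s (M ℕ.∸ 1) s^M≡1 a))) (trans (cong (_* β) (sym ρ≡s^a)) (sym α≡ρβ)))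

    -- Part (2).  Let γ have order m.  Then m ∣ 2(n - 1) =: d·m, and μ(x, y) is
    -- the union of the d cycles  R(s^i γ^j β, 1), 0 ≤ j < m  (0 ≤ i < d).
    module Cycles (m' : ℕ) (γ^m≡1 : γ ^ suc m' ≡ 1#)
                  (m-minimal : ∀ k → 1 ℕ.≤ k → γ ^ k ≡ 1# → suc m' ℕ.≤ k) where
      m : ℕ
      m = suc m'

      γ-order : NoSmallerPeriod γ m
      γ-order e 0<e e<m γ^e≡1 = ℕP.<-irrefl refl (ℕP.<-≤-trans e<m (m-minimal e 0<e γ^e≡1))

      a : ℕ
      a = proj₁ γ∈R

      γ≡s^a : γ ≡ s ^ a
      γ≡s^a = proj₂ γ∈R

      γ^M≡1 : γ ^ M ≡ 1#
      γ^M≡1 = trans (cong (_^ M) γ≡s^a) (trans (^-comm s a M) (trans (cong (_^ a) s^M≡1) (1^ a)))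

      open Period γ m' γ^m≡1 using (pow-cong-mod)

      -- the number of cycles; m ∣ M because γ^M = 1
      d : ℕ
      d = M / m

      d*m≡M : d ℕ.* m ≡ M
      d*m≡M = m/n*n≡m (m%n≡0⇒n∣m M m (pow-injective-mod γ m' γ≢0 γ^m≡1 γ-order M 0 γ^M≡1))

      label : ℕ → ℕ → Carrier
      label i j = s ^ i * γ ^ j

      label^m : ∀ i j → label i j ^ m ≡ s ^ (i ℕ.* m)
      label^m i j = begin
          (s ^ i * γ ^ j) ^ m         ≡⟨ *-^ (s ^ i) (γ ^ j) m ⟩
          (s ^ i) ^ m * (γ ^ j) ^ m   ≡⟨ cong ((s ^ i) ^ m *_) (trans (^-comm γ j m) (trans (cong (_^ j) γ^m≡1) (1^ j))) ⟩
          (s ^ i) ^ m * 1#            ≡⟨ *-identityʳ _ ⟩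
          (s ^ i) ^ m                 ≡⟨ sym (^-* s i m) ⟩
          s ^ (i ℕ.* m)               ∎
        where open ≡-Reasoning

      label-injective : ∀ i i' j j' → i ℕ.< d → i' ℕ.< d → label i j ≡ label i' j' →
                        i ≡ i' × j % m ≡ j' % m
      label-injective i i' j j' i<d i'<d e = i≡i' , pow-injective-mod γ m' γ≢0 γ^m≡1 γ-order j j' γ^j≡γ^j'
        where
        im<M : ∀ x → x ℕ.< d → x ℕ.* m ℕ.< M
        im<M x x<d = subst (x ℕ.* m ℕ.<_) d*m≡M (ℕP.*-monoˡ-< m x<d)
        im≡i'm-mod : (i ℕ.* m) % M ≡ (i' ℕ.* m) % M
        im≡i'm-mod = pow-injective-mod s (M ℕ.∸ 1) s≢0 s^M≡1 s-order (i ℕ.* m) (i' ℕ.* m)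
                       (trans (sym (label^m i j)) (trans (cong (_^ m) e) (label^m i' j')))
        i≡i' : i ≡ i'
        i≡i' = ℕP.*-cancelʳ-≡ i i' m (trans (sym (m<n⇒m%n≡m (im<M i i<d))) (trans im≡i'm-mod (m<n⇒m%n≡m (im<M i' i'<d))))
        γ^j≡γ^j' : γ ^ j ≡ γ ^ j'
        γ^j≡γ^j' = cancelˡ (pow-nz i s≢0) (trans e (cong (λ z → s ^ z * γ ^ j') (sym i≡i')))

      fin-label-injective : ∀ (i i' : Fin d) (j j' : Fin m) → label (toℕ i) (toℕ j) ≡ label (toℕ i') (toℕ j') → i ≡ i' × j ≡ j'
      fin-label-injective i i' j j' e = FinP.toℕ-injective (proj₁ same) ,
          FinP.toℕ-injective (trans (sym (m<n⇒m%n≡m (FinP.toℕ<n j))) (trans (proj₂ same) (m<n⇒m%n≡m (FinP.toℕ<n j'))))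
        where
        same : toℕ i ≡ toℕ i' × toℕ j % m ≡ toℕ j' % m
        same = label-injective (toℕ i) (toℕ i') (toℕ j) (toℕ j') (FinP.toℕ<n i) (FinP.toℕ<n i') e

      -- every power of s is a label: splitting x ∈ Fin M = Fin (d·m) into a
      -- pair (i, j), the map x ↦ i + a·j mod M is injective, hence surjective
      pair : Fin M → Fin d × Fin m
      pair x = Fin.remQuot {d} m (Fin.cast (sym d*m≡M) x)

      pair-injective : ∀ x y → pair x ≡ pair y → x ≡ y
      pair-injective x y e = FinP.toℕ-injective (trans (sym (FinP.toℕ-cast (sym d*m≡M) x))
          (trans (cong toℕ cast-x≡cast-y) (FinP.toℕ-cast (sym d*m≡M) y)))
        where
        combine-pair : ∀ z → Fin.combine (proj₁ (pair z)) (proj₂ (pair z)) ≡ Fin.cast (sym d*m≡M) z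
        combine-pair z = FinP.combine-remQuot {d} m (Fin.cast (sym d*m≡M) z)
        cast-x≡cast-y : Fin.cast (sym d*m≡M) x ≡ Fin.cast (sym d*m≡M) y
        cast-x≡cast-y = trans (sym (combine-pair x)) (trans (cong (λ ij → Fin.combine (proj₁ ij) (proj₂ ij)) e) (combine-pair y))

      label-exponent : Fin d → Fin m → ℕ
      label-exponent i j = toℕ i ℕ.+ a ℕ.* toℕ j

      s^label-exponent : ∀ i j → s ^ label-exponent i j ≡ label (toℕ i) (toℕ j)
      s^label-exponent i j = trans (^-+ s (toℕ i) (a ℕ.* toℕ j))
        (cong (s ^ toℕ i *_) (trans (^-* s a (toℕ j)) (cong (_^ toℕ j) (sym γ≡s^a))))

      exponent : Fin M → Fin M
      exponent x = Fin.fromℕ< (m%n<n (label-exponent (proj₁ (pair x)) (proj₂ (pair x))) M)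

      toℕ-exponent : ∀ x → toℕ (exponent x) ≡ label-exponent (proj₁ (pair x)) (proj₂ (pair x)) % M
      toℕ-exponent x = FinP.toℕ-fromℕ< _

      exponent-injective : ∀ x y → exponent x ≡ exponent y → x ≡ y
      exponent-injective x y e = pair-injective x y (cong₂ _,_ (proj₁ same-pair) (proj₂ same-pair))
        where
        ix iy : Fin d
        ix = proj₁ (pair x)
        iy = proj₁ (pair y)
        jx jy : Fin m
        jx = proj₂ (pair x)
        jy = proj₂ (pair y)
        same-label : label (toℕ ix) (toℕ jx) ≡ label (toℕ iy) (toℕ jy)
        same-label = trans (sym (s^label-exponent ix jx))
          (trans (Period.pow-cong-mod s (M ℕ.∸ 1) s^M≡1 (label-exponent ix jx) (label-exponent iy jy)
                   (trans (sym (toℕ-exponent x)) (trans (cong toℕ e) (toℕ-exponent y))))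
                 (s^label-exponent iy jy))
        same-pair : ix ≡ iy × jx ≡ jy
        same-pair = fin-label-injective ix iy jx jy same-label

      every-power-is-label : ∀ e → ∃ λ i → ∃ λ j → label (toℕ i) (toℕ j) ≡ s ^ e
      every-power-is-label e = hit (injective⇒surjective exponent exponent-injective (Fin.fromℕ< (m%n<n e M)))
        where
        hit : (∃ λ x → exponent x ≡ Fin.fromℕ< (m%n<n e M)) → ∃ λ i → ∃ λ j → label (toℕ i) (toℕ j) ≡ s ^ e
        hit (x , ex) = i , j ,
          trans (sym (s^label-exponent i j)) (Period.pow-cong-mod s (M ℕ.∸ 1) s^M≡1 (label-exponent i j) e
            (trans (sym (toℕ-exponent x)) (trans (cong toℕ ex) (FinP.toℕ-fromℕ< (m%n<n e M)))))
          where
          i : Fin d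
          i = proj₁ (pair x)
          j : Fin m
          j = proj₂ (pair x)

      cycle-label : Fin d → Fin m → Carrier
      cycle-label i j = label (toℕ i) (toℕ j) * β

      cycle-vertex : Fin d → Fin m → V
      cycle-vertex i j = vertex (cycle-label i j)

      γ^∈R : ∀ j → InR (γ ^ j)
      γ^∈R zero = R1
      γ^∈R (suc j) = R* γ∈R (γ^∈R j)

      cycle-label∈Rβ : ∀ i j → InRcoset β (cycle-label i j)
      cycle-label∈Rβ i j = label (toℕ i) (toℕ j) , R* (toℕ i , refl) (γ^∈R (toℕ j)) , refl

      cycle-vertex∈μ : ∀ i j → NonZeroV (cycle-vertex i j) × μ (cycle-vertex i j)
      cycle-vertex∈μ i j = vertex≢0 _ , μ⇐ (cycle-vertex i j) (vertex≢0 _) (_ , cycle-label∈Rβ i j , same-vertex-refl _)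

      cycle-vertex-injective : ∀ i j i' j' → SameVertex (cycle-vertex i j) (cycle-vertex i' j') → i ≡ i' × j ≡ j'
      cycle-vertex-injective i j i' j' same = fin-label-injective i i' j j' (cancelʳ β≢0 (same-vertex-injective same))

      cycle-vertices-cover : ∀ w → NonZeroV w → μ w → ∃ λ i → ∃ λ j → SameVertex (cycle-vertex i j) w
      cycle-vertices-cover w w≢0 w∈μ = covered (μ⇒ w w∈μ)
        where
        covered : (∃ λ α → InRcoset β α × SameVertex (vertex α) w) → ∃ λ i → ∃ λ j → SameVertex (cycle-vertex i j) w
        covered (α , (ρ , (e , ρ≡s^e) , α≡ρβ) , same) = i , j ,
            subst (λ v → SameVertex v w) (cong vertex (sym (trans (cong (_* β) i,j-label) (trans (cong (_* β) (sym ρ≡s^e)) (sym α≡ρβ))))) same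
          where
          i,j : ∃ λ i → ∃ λ j → label (toℕ i) (toℕ j) ≡ s ^ e
          i,j = every-power-is-label e
          i : Fin d
          i = proj₁ i,j
          j : Fin m
          j = proj₁ (proj₂ i,j)
          i,j-label : label (toℕ i) (toℕ j) ≡ s ^ e
          i,j-label = proj₂ (proj₂ i,j)

      successor⇒ : ∀ (j j' : Fin m) → CycSucc m j j' → toℕ j' ≡ suc (toℕ j) % m
      successor⇒ j j' (inj₁ j'≡j+1) = trans j'≡j+1 (sym (m<n⇒m%n≡m (subst (ℕ._< m) j'≡j+1 (FinP.toℕ<n j'))))
      successor⇒ j j' (inj₂ (j'≡0 , j+1≡m)) = trans j'≡0 (sym (trans (cong (_% m) j+1≡m) (n%n≡0 m)))

      successor⇐ : ∀ (j j' : Fin m) → toℕ j' ≡ suc (toℕ j) % m → CycSucc m j j'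
      successor⇐ j j' e with ℕP.m≤n⇒m<n∨m≡n (FinP.toℕ<n j)
      ... | inj₁ j+1<m = inj₁ (trans e (m<n⇒m%n≡m j+1<m))
      ... | inj₂ j+1≡m = inj₂ (trans e (trans (cong (_% m) j+1≡m) (n%n≡0 m)) , j+1≡m)

      -- m ≥ 2, as γ ≠ 1 (γ ∉ E), so no j is its own successor
      no-self-successor : ∀ (j : Fin m) → ¬ CycSucc m j j
      no-self-successor j (inj₁ j≡j+1) = ℕP.<-irrefl j≡j+1 (ℕP.n<1+n (toℕ j))
      no-self-successor j (inj₂ (j≡0 , j+1≡m)) = γ∉E (subst E (sym γ≡1) E1)
        where
        γ≡1 : γ ≡ 1#
        γ≡1 = trans (sym (*-identityʳ γ)) (subst (λ k → γ ^ k ≡ 1#) (trans (sym j+1≡m) (cong suc j≡0)) γ^m≡1)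

      fin-mod : ∀ (j : Fin m) → toℕ j % m ≡ toℕ j
      fin-mod j = m<n⇒m%n≡m (FinP.toℕ<n j)

      label-γ : ∀ i j → cycle-label i j * γ ≡ label (toℕ i) (suc (toℕ j)) * β
      label-γ i j = solve 4 (λ x y b g → x :* y :* b :* g := x :* (g :* y) :* b) refl (s ^ toℕ i) (γ ^ toℕ j) β γ

      γ-step : ∀ i j i' j' → Iff (cycle-label i' j' ≡ cycle-label i j * γ) (i ≡ i' × CycSucc m j j')
      γ-step i j i' j' = forward , backward
        where
        forward : cycle-label i' j' ≡ cycle-label i j * γ → i ≡ i' × CycSucc m j j'
        forward e = sym (FinP.toℕ-injective (proj₁ same)) , successor⇐ j j' (trans (sym (fin-mod j')) (proj₂ same))
          where
          same : toℕ i' ≡ toℕ i × toℕ j' % m ≡ suc (toℕ j) % m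
          same = label-injective (toℕ i') (toℕ i) (toℕ j') (suc (toℕ j)) (FinP.toℕ<n i') (FinP.toℕ<n i)
                   (cancelʳ β≢0 (trans e (label-γ i j)))
        backward : i ≡ i' × CycSucc m j j' → cycle-label i' j' ≡ cycle-label i j * γ
        backward (refl , succ) = trans (cong (λ z → s ^ toℕ i * z * β)
            (pow-cong-mod (toℕ j') (suc (toℕ j)) (trans (fin-mod j') (successor⇒ j j' succ)))) (sym (label-γ i j))

      distinct-cycle-adjacency : ∀ i j i' j' → ¬ SameVertex (cycle-vertex i j) (cycle-vertex i' j') →
                                 Iff (Adj (cycle-vertex i j) (cycle-vertex i' j')) ((i ≡ i') × (CycSucc m j j' ⊎ CycSucc m j' j))
      distinct-cycle-adjacency i j i' j' distinct = (λ adj → steps (proj₁ γ-adjacency adj)) , (λ c → proj₂ γ-adjacency (unsteps c))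
        where
        γ-adjacency : Iff (Adj (cycle-vertex i j) (cycle-vertex i' j'))
                          (cycle-label i' j' ≡ cycle-label i j * γ ⊎ cycle-label i' j' * γ ≡ cycle-label i j)
        γ-adjacency = adjacency (cycle-label i j) (cycle-label i' j') (cycle-label∈Rβ i j) (cycle-label∈Rβ i' j') distinct
        steps : cycle-label i' j' ≡ cycle-label i j * γ ⊎ cycle-label i' j' * γ ≡ cycle-label i j →
                (i ≡ i') × (CycSucc m j j' ⊎ CycSucc m j' j)
        steps (inj₁ forward-step) = proj₁ step , inj₁ (proj₂ step)
          where
          step : i ≡ i' × CycSucc m j j'
          step = proj₁ (γ-step i j i' j') forward-step
        steps (inj₂ backward-step) = sym (proj₁ step) , inj₂ (proj₂ step)
          where
          step : i' ≡ i × CycSucc m j' j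
          step = proj₁ (γ-step i' j' i j) (sym backward-step)
        unsteps : (i ≡ i') × (CycSucc m j j' ⊎ CycSucc m j' j) →
                  cycle-label i' j' ≡ cycle-label i j * γ ⊎ cycle-label i' j' * γ ≡ cycle-label i j
        unsteps (i≡i' , inj₁ succ) = inj₁ (proj₂ (γ-step i j i' j') (i≡i' , succ))
        unsteps (i≡i' , inj₂ succ) = inj₂ (sym (proj₂ (γ-step i' j' i j) (sym i≡i' , succ)))

      cycle-adjacency : ∀ i j i' j' → Iff (Adj (cycle-vertex i j) (cycle-vertex i' j'))
                                          ((i ≡ i') × (CycSucc m j j' ⊎ CycSucc m j' j))
      cycle-adjacency i j i' j' with i FinP.≟ i' | j FinP.≟ j'
      ... | yes refl | yes refl = (λ loop → ⊥-elim (R≢0 loop (trans (B-vertices _ _) (-‿inverseʳ _)))) ,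
                                  (λ { (_ , inj₁ succ) → ⊥-elim (no-self-successor j succ)
                                     ; (_ , inj₂ succ) → ⊥-elim (no-self-successor j succ) })
      ... | yes _ | no j≢j' = distinct-cycle-adjacency i j i' j' (λ same → j≢j' (proj₂ (cycle-vertex-injective i j i' j' same)))
      ... | no i≢i' | _ = distinct-cycle-adjacency i j i' j' (λ same → i≢i' (proj₁ (cycle-vertex-injective i j i' j' same)))

      cycle-decomposition : DisjointCycles μ d m
      cycle-decomposition = cycle-vertex , cycle-vertex∈μ , cycle-vertex-injective , cycle-vertices-cover , cycle-adjacency

    μ-cycles : ∀ m → IsOrder γ m → ∃ λ d → (d ℕ.* m ≡ M) × DisjointCycles μ d m
    μ-cycles zero (() , _)
    μ-cycles (suc m') (_ , γ^m≡1 , m-minimal) = d , d*m≡M , cycle-decomposition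
      where open Cycles m' γ^m≡1 m-minimal

lemma3p5 : (p k n : ℕ) → Prime p → p ≢ 2 → n ≡ p ^ℕ suc k →
    (F : Field) → Field.Carrier F ↔ Fin (n *ℕ n) →
    (ω : Field.Carrier F) →
    let open Field F
        open Setup F n ω
    in Primitive →
    (β : Carrier) → β ≢ 0# → ¬ InR β →
    (βinv : Carrier) → β * βinv ≡ 1# →
    (βev βodd : Carrier) → EvOdd β βev βodd →
    (γ : Carrier) → γ * βodd ≡ βev →
    let y = βinv · f
        μ = CommonNbr e y
    in
    -- (1)
    ( Dist2 e y
    × (∀ w → NonZeroV w → Iff (μ w) (∃ λ α → InRcoset β α × SameVertex ((α · e) ⊕ f) w))
    × HasSize μ (2 *ℕ (n ∸ 1))
    × (∀ α α' → InRcoset β α → InRcoset β α' → ¬ SameVertex ((α · e) ⊕ f) ((α' · e) ⊕ f) →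
         Iff (Adj ((α · e) ⊕ f) ((α' · e) ⊕ f)) (α' ≡ α * γ ⊎ α' * γ ≡ α)) )
    -- (2)
    × (∀ m → IsOrder γ m → ∃ λ d → (d *ℕ m ≡ 2 *ℕ (n ∸ 1)) × DisjointCycles μ d m)
lemma3p5 p k n p-prime p≢2 n≡p^k+1 with NatFacts.odd-prime-power p k n p-prime p≢2 n≡p^k+1
... | p' , T' , refl , refl =
  λ F bij ω ω-primitive β β≢0 β∉R βinv ββinv≡1 βev βodd β-split γ γβodd≡βev →
    let open SquareField p' k T' p-prime F n≡p^k+1 bij ω ω-primitive
        open CommonNeighbours β β≢0 β∉R βinv ββinv≡1 βev βodd β-split γ γβodd≡βev
    in (distance-two , μ-description , μ-size , adjacency) , μ-cycles
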